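{- Let $\pi_0\vdash F,G,\Gamma$, $\pi_1\vdash\bar F,\Delta$ and $\pi_2\vdash\bar G,\Lambda$ be LK-proofs. Let $\pi\vdash\Gamma,\Delta,\Lambda$ be the proof obtained by first cutting $\pi_0$ with $\pi_1$ on $F$ (giving $G,\Gamma,\Delta$) and then cutting the result with $\pi_2$ on $G$; and let $\pi'\vdash\Gamma,\Delta,\Lambda$ be the proof obtained by first cutting $\pi_0$ with $\pi_2$ on $G$ (giving $F,\Gamma,\Lambda$) and then cutting the result with $\pi_1$ on $F$. If either $F$ or $G$ is $\Sigma_2$, then $L(\pi)=L(\pi')$.
   Context: One-sided LK: formulas in negation normal form, $\bar A$ the dual, sequents finite sequences (implicit permutations allowed), $\lvert\Gamma\rvert$ the length. Axioms $\bar A,A$ ($A$ atomic); rules $\lor,\land,\forall$ (eigenvariable), $\exists$, cut, weakening, contraction, permutation. All formulas are prenex $\Pi_2$/$\Sigma_2$; proofs are regular. The language $L(\pi)$ is defined for proofs of sequents of prenex $\Sigma_1$ formulas, as follows. Types: $o$ = structured first-order terms (first-order terms closed under explicit substitution $s[\alpha\mapsto t]$), $\epsilon$ unit type with element $\langle\rangle$; closed under $\times$ (pairs $u\star u'$) and $\to$. $o^0=\epsilon$, $o^{k+1}=o\times o^k$, $\langle u_0,\dots,u_{k-1}\rangle=u_0\star\cdots\star u_{k-1}\star\langle\rangle$. For $F=\forall^m\exists^n G$ ($G$ quantifier-free): $\tau_F=o^n,\tau^*_F=o^m$; for $F=\exists^m\forall^nG$, $n>0$: $\tau_F=o^m$,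 $\tau^*_F=o\to\cdots\to o\to o^n$ ($m$ arguments). Grammar: for each subproof $\rho\vdash A_0,\dots,A_n$ and $i\le n$ a non-terminal $\sigma^i_\rho:\tau^*_{A_0}\to\cdots\to\tau^*_{A_n}\to\tau_{A_i}$, with production rules by the last inference of $\rho$: axiom $\rho\vdash\bar A,A$: $\sigma^i_\rho z_0z_1\to z_{1-i}$. $\forall$ ($\rho\vdash\forall vA,\Gamma$ from $\rho_0\vdash A(v/\alpha),\Gamma$): $\sigma^i_\rho(z_0\star z_1)\vec y\to(\sigma^i_{\rho_0}z_1\vec y)[\alpha\mapsto z_0]$. $\exists$ ($\rho\vdash\exists vA,\Gamma$ from $\rho_0\vdash A(v/r),\Gamma$): $\sigma^0_\rho z\vec y\to r\star\sigma^0_{\rho_0}(z\cdot r)\vec y$, $\sigma^i_\rho z\vec y\to\sigma^i_{\rho_0}(z\cdot r)\vec y$ ($i>0$), with $z\cdot r=z$ if $z:\epsilon$, else $zr$. Cut ($\rho\vdash\Gamma,\Delta$ from $\rho_0\vdash A,\Gamma$, $\rho_1\vdash\bar A,\Delta$; $\vec x,\vec y$ of lengths $\lvert\Gamma\rvert,\lvert\Delta\rvert$): $\sigma^i_\rho\vec x\vec y\to\sigma^{i+1}_{\rho_0}((\sigma^0_{\rho_1}\circ_{\bar A}\sigma^0_{\rho_0})\vec y\vec x)\vec x$ for $i<\lvert\Gamma\rvert$, and $\sigma^i_\rho\vec x\vec y\to\sigma^{i-\lvert\Gamma\rvert+1}_{\rho_1}((\sigma^0_{\rho_0}\circ_A\sigma^0_{\rho_1})\vec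 x\vec y)\vec y$ otherwise; where for $\theta_0\vdash F,\Gamma'$, $\theta_1\vdash\bar F,\Delta'$, $(\sigma^0_{\theta_0}\circ_F\sigma^0_{\theta_1})\vec x\vec y$ equals $\langle\rangle$ ($F$ quantifier-free), $\lambda z_0\cdots z_m.\sigma^0_{\theta_0}\langle z_0..z_m\rangle\vec x$ ($F=\forall v_0\cdots\forall v_mG$, $G\in\Sigma_1$), or $\sigma^0_{\theta_0}(\lambda z_0\cdots z_m.\sigma^0_{\theta_1}\langle z_0..z_m\rangle\vec y)\vec x$ ($F=\exists v_0\cdots\exists v_mG$, $G\in\Pi_1$). Contraction ($\rho\vdash A,\Gamma$ from $\rho_0\vdash A,A,\Gamma$): $\sigma^0_\rho z\vec y\to\sigma^0_{\rho_0}zz\vec y\mid\sigma^1_{\rho_0}zz\vec y$, $\sigma^i_\rho z\vec y\to\sigma^{i+1}_{\rho_0}zz\vec y$ ($i>0$). Weakening ($\rho\vdash A,\Gamma$ from $\rho_0\vdash\Gamma$): $\sigma^0_\rho z\vec y\to\langle\mathsf c,\dots,\mathsf c\rangle$ (one fixed constant per existential quantifier of $A$), $\sigma^i_\rho z\vec y\to\sigma^{i-1}_{\rho_0}\vec y$. Permutation ($\rho\vdash\Gamma,A,B,\Delta$ from $\rho_0\vdash\Gamma,B,A,\Delta$): $\sigma^i_\rho\vec xz_0z_1\vec y\to\sigma^j_{\rho_0}\vec xz_1z_0\vec y$, $j$ the index of the $i$-th formula after swapping. Language: derivations apply production rules and $\beta$-reductions. For $\pi\vdash\exists\vec v_0A_0,\dots,\exists\vec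 v_kA_k$ ($A_i$ quantifier-free, $\exists\vec v_i$ a block of length $a_i$), $L(\pi)$ is the set of pairs $(i,T^*)$, $i\le k$, where $T:o^{a_i}$ is a non-terminal-free sequence-term derivable from $\sigma^i_\pi\langle\rangle\cdots\langle\rangle$ and $T^*$ is the result of evaluating all explicit substitutions in $T$. -}

module Defs where

open import Data.Nat using (ℕ; zero; suc; _+_; _∸_; _<_; _≤_; _<ᵇ_; _≡ᵇ_; pred)
open import Data.Bool using (Bool; true; false; if_then_else_; _∧_)
open import Data.Unit using (⊤)
open import Data.List using (List; []; _∷_; _++_; length; map; replicate; foldr; foldl; downFrom)
open import Data.List.Relation.Unary.All using (All)
open import Data.List.Relation.Unary.Unique.Propositional using (Unique)
open import Data.List.Membership.Propositional using (_∉_)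
open import Data.Maybe using (Maybe; just; nothing; _>>=_)
import Data.Maybe as M
open import Data.Product using (Σ; _×_; _,_; ∃)
open import Data.Sum using (_⊎_)
open import Relation.Binary.PropositionalEquality using (_≡_)
open import Relation.Binary.Construct.Closure.ReflexiveTransitive using (Star)

-- First-order syntax (locally nameless).
-- bv n : bound variable (de Bruijn index), fv α : free variable /
-- eigenvariable α, fn f ts : function symbol f applied to ts
-- (arbitrary first-order language: symbols are named by ℕ).

data Term : Set where
  bv : ℕ → Term
  fv : ℕ → Term
  fn : ℕ → List Term → Term

-- formulas in negation normal form
data Formula : Set where
  posF negF : ℕ → List Term → Formula
  andF orF  : Formula → Formula → Formula
  allF exF  : Formula → Formula           -- binds bv 0 in the body

dual : Formula → Formula
dual (posF p ts) = negF p ts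
dual (negF p ts) = posF p ts
dual (andF A B)  = orF (dual A) (dual B)
dual (orF A B)   = andF (dual A) (dual B)
dual (allF A)    = exF (dual A)
dual (exF A)     = allF (dual A)

mutual
  openT : ℕ → Term → Term → Term
  openT k t (bv n)    = if n ≡ᵇ k then t else bv n
  openT k t (fv a)    = fv a
  openT k t (fn f ts) = fn f (openTs k t ts)

  openTs : ℕ → Term → List Term → List Term
  openTs k t []       = []
  openTs k t (s ∷ ss) = openT k t s ∷ openTs k t ss

openF : ℕ → Term → Formula → Formula
openF k t (posF p ts) = posF p (openTs k t ts)
openF k t (negF p ts) = negF p (openTs k t ts)
openF k t (andF A B)  = andF (openF k t A) (openF k t B)
openF k t (orF A B)   = orF (openF k t A) (openF k t B)
openF k t (allF A)    = allF (openF (suc k) t A)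
openF k t (exF A)     = exF (openF (suc k) t A)

inst : Formula → Term → Formula
inst A t = openF 0 t A

mutual
  replT : ℕ → Term → Term → Term
  replT α t (bv n)    = bv n
  replT α t (fv a)    = if a ≡ᵇ α then t else fv a
  replT α t (fn f ts) = fn f (replTs α t ts)

  replTs : ℕ → Term → List Term → List Term
  replTs α t []       = []
  replTs α t (s ∷ ss) = replT α t s ∷ replTs α t ss

mutual
  fvT : Term → List ℕ
  fvT (bv n)    = []
  fvT (fv a)    = a ∷ []
  fvT (fn f ts) = fvTs ts

  fvTs : List Term → List ℕ
  fvTs []       = []
  fvTs (t ∷ ts) = fvT t ++ fvTs ts

fvF : Formula → List ℕ
fvF (posF p ts) = fvTs ts
fvF (negF p ts) = fvTs ts
fvF (andF A B)  = fvF A ++ fvF B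
fvF (orF A B)   = fvF A ++ fvF B
fvF (allF A)    = fvF A
fvF (exF A)     = fvF A

mutual
  LCT : ℕ → Term → Set
  LCT k (bv n)    = n < k
  LCT k (fv a)    = ⊤
  LCT k (fn f ts) = LCTs k ts

  LCTs : ℕ → List Term → Set
  LCTs k []       = ⊤
  LCTs k (t ∷ ts) = LCT k t × LCTs k ts

LCF : ℕ → Formula → Set
LCF k (posF p ts) = LCTs k ts
LCF k (negF p ts) = LCTs k ts
LCF k (andF A B)  = LCF k A × LCF k B
LCF k (orF A B)   = LCF k A × LCF k B
LCF k (allF A)    = LCF (suc k) A
LCF k (exF A)     = LCF (suc k) A

data QF : Formula → Set where
  posQ : ∀ {p ts} → QF (posF p ts)
  negQ : ∀ {p ts} → QF (negF p ts)
  andQ : ∀ {A B} → QF A → QF B → QF (andF A B)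
  orQ  : ∀ {A B} → QF A → QF B → QF (orF A B)

allN exN : ℕ → Formula → Formula
allN zero    A = A
allN (suc m) A = allF (allN m A)
exN zero    A = A
exN (suc m) A = exF (exN m A)

IsΣ1 IsΠ1 IsΣ2 IsΠ2 : Formula → Set
IsΣ1 F = Σ ℕ λ m → Σ Formula λ G → QF G × F ≡ exN m G
IsΠ1 F = Σ ℕ λ m → Σ Formula λ G → QF G × F ≡ allN m G
IsΣ2 F = Σ ℕ λ m → Σ ℕ λ n → Σ Formula λ G → QF G × F ≡ exN m (allN n G)
IsΠ2 F = Σ ℕ λ m → Σ ℕ λ n → Σ Formula λ G → QF G × F ≡ allN m (exN n G)

GoodF : Formula → Set
GoodF F = (IsΣ2 F ⊎ IsΠ2 F) × LCF 0 F

qf : Formula → Bool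
qf (posF _ _) = true
qf (negF _ _) = true
qf (andF A B) = qf A ∧ qf B
qf (orF A B)  = qf A ∧ qf B
qf (allF _)   = false
qf (exF _)    = false

leadAll leadEx : Formula → ℕ
leadAll (allF A) = suc (leadAll A)
leadAll _        = 0
leadEx (exF A) = suc (leadEx A)
leadEx _       = 0

stripAll stripEx : Formula → Formula
stripAll (allF A) = stripAll A
stripAll A        = A
stripEx (exF A) = stripEx A
stripEx A       = A

numEx : Formula → ℕ
numEx (posF _ _) = 0
numEx (negF _ _) = 0
numEx (andF A B) = numEx A + numEx B
numEx (orF A B)  = numEx A + numEx B
numEx (allF A)   = numEx A
numEx (exF A)    = suc (numEx A)

-- LK proofs (one-sided), raw trees; the principal formula is in front.

data Proof : Set where
  ax    : Formula → Proof
  orR   : Proof → Proof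
  andR  : Proof → Proof → Proof
  allR  : ℕ → Formula → Proof → Proof
  exR   : Formula → Term → Proof → Proof
  cut   : Formula → Proof → Proof → Proof
  weak  : Formula → Proof → Proof
  contr : Proof → Proof
  perm  : ℕ → Proof → Proof

infix 4 _⊢_
data _⊢_ : Proof → List Formula → Set where
  axD    : ∀ {p ts} → ax (posF p ts) ⊢ negF p ts ∷ posF p ts ∷ []
  orD    : ∀ {ρ A B Γ} → ρ ⊢ A ∷ B ∷ Γ → orR ρ ⊢ orF A B ∷ Γ
  andD   : ∀ {ρ₀ ρ₁ A B Γ} → ρ₀ ⊢ A ∷ Γ → ρ₁ ⊢ B ∷ Γ → andR ρ₀ ρ₁ ⊢ andF A B ∷ Γ
  allD   : ∀ {ρ α A Γ} → α ∉ fvF (allF A) → All (λ B → α ∉ fvF B) Γ →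
           ρ ⊢ inst A (fv α) ∷ Γ → allR α A ρ ⊢ allF A ∷ Γ
  exD    : ∀ {ρ r A Γ} → LCT 0 r → ρ ⊢ inst A r ∷ Γ → exR A r ρ ⊢ exF A ∷ Γ
  cutD   : ∀ {ρ₀ ρ₁ A Γ Δ} → ρ₀ ⊢ A ∷ Γ → ρ₁ ⊢ dual A ∷ Δ → cut A ρ₀ ρ₁ ⊢ Γ ++ Δ
  weakD  : ∀ {ρ A Γ} → ρ ⊢ Γ → weak A ρ ⊢ A ∷ Γ
  contrD : ∀ {ρ A Γ} → ρ ⊢ A ∷ A ∷ Γ → contr ρ ⊢ A ∷ Γ
  permD  : ∀ {ρ A B Γ Δ} → ρ ⊢ Γ ++ B ∷ A ∷ Δ → perm (length Γ) ρ ⊢ Γ ++ A ∷ B ∷ Δ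

seqs : ∀ {ρ Γ} → ρ ⊢ Γ → List (List Formula)
seqs {Γ = Γ} axD            = Γ ∷ []
seqs {Γ = Γ} (orD d)        = Γ ∷ seqs d
seqs {Γ = Γ} (andD d e)     = Γ ∷ seqs d ++ seqs e
seqs {Γ = Γ} (allD _ _ d)   = Γ ∷ seqs d
seqs {Γ = Γ} (exD _ d)      = Γ ∷ seqs d
seqs {Γ = Γ} (cutD d e)     = Γ ∷ seqs d ++ seqs e
seqs {Γ = Γ} (weakD d)      = Γ ∷ seqs d
seqs {Γ = Γ} (contrD d)     = Γ ∷ seqs d
seqs {Γ = Γ} (permD d)      = Γ ∷ seqs d

AllPrenex : ∀ {ρ Γ} → ρ ⊢ Γ → Set
AllPrenex d = All (All GoodF) (seqs d)

eig : Proof → List ℕ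
eig (ax _)       = []
eig (orR ρ)      = eig ρ
eig (andR ρ σ)   = eig ρ ++ eig σ
eig (allR α _ ρ) = α ∷ eig ρ
eig (exR _ _ ρ)  = eig ρ
eig (cut _ ρ σ)  = eig ρ ++ eig σ
eig (weak _ ρ)   = eig ρ
eig (contr ρ)    = eig ρ
eig (perm _ ρ)   = eig ρ

Regular : Proof → Set
Regular ρ = Unique (eig ρ)

-- length of the end-sequent
arity : Proof → ℕ
arity (ax _)       = 2
arity (orR ρ)      = pred (arity ρ)
arity (andR ρ _)   = arity ρ
arity (allR _ _ ρ) = arity ρ
arity (exR _ _ ρ)  = arity ρ
arity (cut _ ρ σ)  = pred (arity ρ) + pred (arity σ)
arity (weak _ ρ)   = suc (arity ρ)
arity (contr ρ)    = pred (arity ρ)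
arity (perm _ ρ)   = arity ρ

-- Terms of the grammar: simply typed λ-terms (de Bruijn) over
-- structured first-order terms, with non-terminals σ^i_ρ = nt ρ i.

data Tm : Set where
  var  : ℕ → Tm
  lam  : Tm → Tm
  app  : Tm → Tm → Tm
  unit : Tm
  pair : Tm → Tm → Tm
  ft   : Term → Tm
  esub : Tm → ℕ → Tm → Tm
  nt   : Proof → ℕ → Tm

shift : ℕ → ℕ → Tm → Tm
shift c d (var n)      = if n <ᵇ c then var n else var (n + d)
shift c d (lam b)      = lam (shift (suc c) d b)
shift c d (app s t)    = app (shift c d s) (shift c d t)
shift c d unit         = unit
shift c d (pair s t)   = pair (shift c d s) (shift c d t)
shift c d (ft r)       = ft r
shift c d (esub s α t) = esub (shift c d s) α (shift c d t)
shift c d (nt ρ i)     = nt ρ i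

substAt : ℕ → Tm → Tm → Tm
substAt k a (var n)      = if n <ᵇ k then var n else (if n ≡ᵇ k then shift 0 k a else var (pred n))
substAt k a (lam b)      = lam (substAt (suc k) a b)
substAt k a (app s t)    = app (substAt k a s) (substAt k a t)
substAt k a unit         = unit
substAt k a (pair s t)   = pair (substAt k a s) (substAt k a t)
substAt k a (ft r)       = ft r
substAt k a (esub s α t) = esub (substAt k a s) α (substAt k a t)
substAt k a (nt ρ i)     = nt ρ i

apps : Tm → List Tm → Tm
apps = foldl app

seqT : List Tm → Tm
seqT = foldr pair unit

lamN : ℕ → Tm → Tm
lamN zero    t = t
lamN (suc k) t = lam (lamN k t)

-- ⟨z₀,…,z_{k-1}⟩ for the variables bound by lamN k (z₀ outermost)
vars : ℕ → Tm
vars k = seqT (map var (downFrom k))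

-- z·r  for z : τ*_{∃vA}   (τ* = ε iff ∃vA is Σ1)
dot : Formula → Tm → Term → Tm
dot F z r = if qf (stripEx F) then z else app z (ft r)

-- (σ⁰_{θ₀} ∘_F σ⁰_{θ₁}) x⃗ y⃗   for θ₀ ⊢ F,Γ' and θ₁ ⊢ F̄,Δ'
circ : Formula → Proof → Proof → List Tm → List Tm → Tm
circ F@(allF _) θ₀ θ₁ xs ys =
  if qf (stripAll F) then unit
  else lamN (leadAll F) (apps (nt θ₀ 0) (vars (leadAll F) ∷ map (shift 0 (leadAll F)) xs))
circ F@(exF _) θ₀ θ₁ xs ys =
  if qf (stripEx F) then apps (nt θ₀ 0) (unit ∷ xs)
  else apps (nt θ₀ 0)
         (lamN (leadEx F) (apps (nt θ₁ 0) (vars (leadEx F) ∷ map (shift 0 (leadEx F)) ys)) ∷ xs)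
circ _ θ₀ θ₁ xs ys = unit

swapIdx : ℕ → ℕ → ℕ
swapIdx k i = if i ≡ᵇ k then suc k else (if i ≡ᵇ suc k then k else i)

-- production rules  σ^i_ρ a⃗ → t ; c is the fixed constant symbol
data Prod (c : ℕ) : Proof → ℕ → List Tm → Tm → Set where
  ax0    : ∀ {A z₀ z₁} → Prod c (ax A) 0 (z₀ ∷ z₁ ∷ []) z₁
  ax1    : ∀ {A z₀ z₁} → Prod c (ax A) 1 (z₀ ∷ z₁ ∷ []) z₀
  or0    : ∀ {ρ z ys} → Prod c (orR ρ) 0 (z ∷ ys) (apps (nt ρ 0) (z ∷ z ∷ ys))
  or1    : ∀ {ρ z ys} → Prod c (orR ρ) 0 (z ∷ ys) (apps (nt ρ 1) (z ∷ z ∷ ys))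
  orS    : ∀ {ρ i z ys} → Prod c (orR ρ) (suc i) (z ∷ ys) (apps (nt ρ (suc (suc i))) (z ∷ z ∷ ys))
  andP₀  : ∀ {ρ₀ ρ₁ i zs} → Prod c (andR ρ₀ ρ₁) i zs (apps (nt ρ₀ i) zs)
  andP₁  : ∀ {ρ₀ ρ₁ i zs} → Prod c (andR ρ₀ ρ₁) i zs (apps (nt ρ₁ i) zs)
  allP   : ∀ {α A ρ i z₀ z₁ ys} →
           Prod c (allR α A ρ) i (pair z₀ z₁ ∷ ys) (esub (apps (nt ρ i) (z₁ ∷ ys)) α z₀)
  ex0    : ∀ {A r ρ z ys} →
           Prod c (exR A r ρ) 0 (z ∷ ys) (pair (ft r) (apps (nt ρ 0) (dot (exF A) z r ∷ ys)))
  exS    : ∀ {A r ρ i z ys} →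
           Prod c (exR A r ρ) (suc i) (z ∷ ys) (apps (nt ρ (suc i)) (dot (exF A) z r ∷ ys))
  cutL   : ∀ {A ρ₀ ρ₁ i xs ys} → length xs ≡ pred (arity ρ₀) → i < length xs →
           Prod c (cut A ρ₀ ρ₁) i (xs ++ ys)
                (apps (nt ρ₀ (suc i)) (circ (dual A) ρ₁ ρ₀ ys xs ∷ xs))
  cutR   : ∀ {A ρ₀ ρ₁ i xs ys} → length xs ≡ pred (arity ρ₀) → length xs ≤ i →
           Prod c (cut A ρ₀ ρ₁) i (xs ++ ys)
                (apps (nt ρ₁ (suc (i ∸ length xs))) (circ A ρ₀ ρ₁ xs ys ∷ ys))
  weak0  : ∀ {A ρ z ys} → Prod c (weak A ρ) 0 (z ∷ ys) (seqT (replicate (numEx A) (ft (fn c []))))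
  weakS  : ∀ {A ρ i z ys} → Prod c (weak A ρ) (suc i) (z ∷ ys) (apps (nt ρ i) ys)
  contr0 : ∀ {ρ z ys} → Prod c (contr ρ) 0 (z ∷ ys) (apps (nt ρ 0) (z ∷ z ∷ ys))
  contr1 : ∀ {ρ z ys} → Prod c (contr ρ) 0 (z ∷ ys) (apps (nt ρ 1) (z ∷ z ∷ ys))
  contrS : ∀ {ρ i z ys} → Prod c (contr ρ) (suc i) (z ∷ ys) (apps (nt ρ (suc (suc i))) (z ∷ z ∷ ys))
  permP  : ∀ {k ρ i xs z₀ z₁ ys} → length xs ≡ k →
           Prod c (perm k ρ) i (xs ++ z₀ ∷ z₁ ∷ ys) (apps (nt ρ (swapIdx k i)) (xs ++ z₁ ∷ z₀ ∷ ys))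

data Root (c : ℕ) : Tm → Tm → Set where
  beta : ∀ {b a} → Root c (app (lam b) a) (substAt 0 a b)
  prod : ∀ {ρ i as t} → i < arity ρ → length as ≡ arity ρ → Prod c ρ i as t →
         Root c (apps (nt ρ i) as) t

data Step (c : ℕ) : Tm → Tm → Set where
  root   : ∀ {s t} → Root c s t → Step c s t
  lamS   : ∀ {s t} → Step c s t → Step c (lam s) (lam t)
  appL   : ∀ {s t u} → Step c s t → Step c (app s u) (app t u)
  appR   : ∀ {s t u} → Step c s t → Step c (app u s) (app u t)
  pairL  : ∀ {s t u} → Step c s t → Step c (pair s u) (pair t u)
  pairR  : ∀ {s t u} → Step c s t → Step c (pair u s) (pair u t)
  esubL  : ∀ {s t u α} → Step c s t → Step c (esub s α u) (esub t α u)
  esubR  : ∀ {s t u α} → Step c s t → Step c (esub u α s) (esub u α t)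

Derives : ℕ → Tm → Tm → Set
Derives c = Star (Step c)

evalO : Tm → Maybe Term
evalO (ft r)       = just r
evalO (esub s α t) = evalO s >>= λ s' → evalO t >>= λ t' → just (replT α t' s')
evalO _            = nothing

evalSeq : Tm → Maybe (List Term)
evalSeq unit         = just []
evalSeq (pair u v)   = evalO u >>= λ u' → evalSeq v >>= λ vs → just (u' ∷ vs)
evalSeq (esub s α t) = evalSeq s >>= λ ss → evalO t >>= λ t' → just (replTs α t' ss)
evalSeq _            = nothing

exLen : List Formula → ℕ → ℕ
exLen []      _       = 0
exLen (A ∷ _) zero    = numEx A
exLen (_ ∷ Θ) (suc i) = exLen Θ i

-- L(π) for π ⊢ Θ (Θ a sequent of prenex Σ1 formulas), c the fixed constant
L : ℕ → Proof → List Formula → ℕ × List Term → Set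
L c π Θ (i , ts) =
  i < length Θ ×
  Σ Tm λ T → Derives c (apps (nt π i) (replicate (length Θ) unit)) T ×
             evalSeq T ≡ just ts × length ts ≡ exLen Θ i

-- move the formula at position k+l to position k (by l adjacent swaps)
moveLeft : ℕ → ℕ → Proof → Proof
moveLeft k zero    ρ = ρ
moveLeft k (suc l) ρ = perm k (moveLeft (suc k) l ρ)

-- from  X,Λ,Δ  to  X,Δ,Λ  with |X| = g, |Λ| = l, |Δ| = d
blockSwap : ℕ → ℕ → ℕ → Proof → Proof
blockSwap g l zero    ρ = ρ
blockSwap g l (suc d) ρ = blockSwap (suc g) l d (moveLeft g l ρ)

piFG : Formula → Formula → Proof → Proof → Proof → Proof
piFG F G π₀ π₁ π₂ = cut G (cut F π₀ π₁) π₂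

-- π' : cut π₀ (permuted to G,F,Γ) with π₂ on G (giving F,Γ,Λ), then with π₁ on F
-- (giving Γ,Λ,Δ), then permute to Γ,Δ,Λ
piGF : List Formula → List Formula → List Formula →
       Formula → Formula → Proof → Proof → Proof → Proof
piGF Γ Δ Λ F G π₀ π₁ π₂ =
  blockSwap (length Γ) (length Λ) (length Δ) (cut F (cut G (perm 0 π₀) π₂) π₁)

module Submission where

-- The productions of a cut or permutation non-terminal are deterministic, so unfolding such
-- non-terminals (in parallel, anywhere in a term) commutes with derivations: a term and its
-- unfolding derive the same evaluated terms. It therefore suffices to connect, for every i,
-- the start terms σ^i_π ⟨⟩…⟨⟩ and σ^i_π' ⟨⟩…⟨⟩ by unfolding steps in either direction.
-- Unfolding both reaches a call of σ_π₀, σ_π₁ or σ_π₂ whose arguments are ∘-terms. If F is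
-- Σ2, the argument plugged in for F is λz⃗. σ⁰_π₁ ⟨z⃗⟩ ⟨⟩…⟨⟩, independent of the proof π₁ is cut
-- against and of the other arguments, so both nestings feed π₀, π₁, π₂ the same arguments up
-- to unfolding; symmetrically if G is Σ2.

open import Defs
open import Data.Bool using (true; false; if_then_else_; T)
open import Data.Empty using (⊥; ⊥-elim)
open import Data.List using (List; []; _∷_; _++_; length; map; replicate)
open import Data.List.Properties using (map-++; length-map; ++-assoc; length-++; ++-identityʳ; ∷-injective; map-replicate; length-replicate)
import Data.List.Relation.Binary.Pointwise as Pointwise
open Pointwise using (Pointwise; []; _∷_; ++⁺; Pointwise-length)
open import Data.List.Relation.Unary.All using (All)
open import Data.Maybe using (Maybe; just; nothing; _>>=_)
open import Data.Nat
open import Data.Nat.Properties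
open import Data.Nat.Tactic.RingSolver using (solve-∀)
open import Data.Product using (Σ; ∃; ∃₂; _×_; _,_; proj₁; proj₂)
open import Data.Sum using (_⊎_; inj₁; inj₂)
open import Function.Bundles using (_⇔_; mk⇔)
open import Relation.Binary.Construct.Closure.Equivalence as EqClosure using (EqClosure)
open import Relation.Binary.Construct.Closure.Symmetric using (fwd; bwd)
open import Relation.Binary.Construct.Closure.ReflexiveTransitive using (ε; _◅_; _◅◅_; gmap)
open import Relation.Binary.Definitions using (tri<; tri≈; tri>)
open import Relation.Binary.PropositionalEquality
open import Relation.Nullary using (yes; no; contradiction)

-- De Bruijn shifting and substitution

if-<ᵇ-then : ∀ {A : Set} {x y : A} n c → n < c → (if n <ᵇ c then x else y) ≡ x
if-<ᵇ-then n c p with n <ᵇ c | <⇒<ᵇ p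
... | true | _ = refl
... | false | ()

if-<ᵇ-else : ∀ {A : Set} {x y : A} n c → c ≤ n → (if n <ᵇ c then x else y) ≡ y
if-<ᵇ-else n c p with n <ᵇ c in eq
... | false = refl
... | true = ⊥-elim (<⇒≱ (<ᵇ⇒< n c (subst T (sym eq) _)) p)

if-≡ᵇ-refl : ∀ {A : Set} {x y : A} n → (if n ≡ᵇ n then x else y) ≡ x
if-≡ᵇ-refl n with n ≡ᵇ n | ≡⇒≡ᵇ n n refl
... | true | _ = refl
... | false | ()

if-≡ᵇ-else : ∀ {A : Set} {x y : A} n k → n ≢ k → (if n ≡ᵇ k then x else y) ≡ y
if-≡ᵇ-else n k p with n ≡ᵇ k in eq
... | false = refl
... | true = ⊥-elim (p (≡ᵇ⇒≡ n k (subst T (sym eq) _)))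

shift-var-< : ∀ {n c d} → n < c → shift c d (var n) ≡ var n
shift-var-< {n} {c} p = if-<ᵇ-then n c p

shift-var-≥ : ∀ {n c d} → c ≤ n → shift c d (var n) ≡ var (n + d)
shift-var-≥ {n} {c} p = if-<ᵇ-else n c p

substAt-var-< : ∀ {n k a} → n < k → substAt k a (var n) ≡ var n
substAt-var-< {n} {k} p = if-<ᵇ-then n k p

substAt-var-≡ : ∀ {k a} → substAt k a (var k) ≡ shift 0 k a
substAt-var-≡ {k} = trans (if-<ᵇ-else k k ≤-refl) (if-≡ᵇ-refl k)

substAt-var-> : ∀ {n k a} → k < n → substAt k a (var n) ≡ var (pred n)
substAt-var-> {n} {k} p = trans (if-<ᵇ-else n k (<⇒≤ p)) (if-≡ᵇ-else n k (λ e → <⇒≢ p (sym e)))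

shift-shift : ∀ {m d} y {c₀ c C} → c₀ ≤ c → C ≡ m + c →
       shift C d (shift c₀ m y) ≡ shift c₀ m (shift c d y)
shift-shift {m} {d} (var n) {c₀} {c} {C} le eq with n <? c₀
... | yes n<c₀ = begin
      shift C d (shift c₀ m (var n)) ≡⟨ cong (shift C d) (shift-var-< n<c₀) ⟩
      shift C d (var n) ≡⟨ shift-var-< (subst (n <_) (sym eq) (≤-trans n<c₀ (≤-trans le (m≤n+m c m)))) ⟩
      var n ≡⟨ sym (shift-var-< n<c₀) ⟩
      shift c₀ m (var n) ≡⟨ cong (shift c₀ m) (sym (shift-var-< (≤-trans n<c₀ le))) ⟩
      shift c₀ m (shift c d (var n)) ∎
  where open ≡-Reasoning
... | no n≮c₀ with n <? c
...   | yes n<c = begin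
      shift C d (shift c₀ m (var n)) ≡⟨ cong (shift C d) (shift-var-≥ (≮⇒≥ n≮c₀)) ⟩
      shift C d (var (n + m)) ≡⟨ shift-var-< (subst (n + m <_) (sym eq) (subst (_< m + c) (+-comm m n) (+-monoʳ-< m n<c))) ⟩
      var (n + m) ≡⟨ sym (shift-var-≥ (≮⇒≥ n≮c₀)) ⟩
      shift c₀ m (var n) ≡⟨ cong (shift c₀ m) (sym (shift-var-< n<c)) ⟩
      shift c₀ m (shift c d (var n)) ∎
  where open ≡-Reasoning
...   | no n≮c = begin
      shift C d (shift c₀ m (var n)) ≡⟨ cong (shift C d) (shift-var-≥ (≮⇒≥ n≮c₀)) ⟩
      shift C d (var (n + m)) ≡⟨ shift-var-≥ (subst (_≤ n + m) (sym eq) (subst (m + c ≤_) (+-comm m n) (+-monoʳ-≤ m (≮⇒≥ n≮c)))) ⟩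
      var (n + m + d) ≡⟨ cong var (trans (+-assoc n m d) (trans (cong (n +_) (+-comm m d)) (sym (+-assoc n d m)))) ⟩
      var (n + d + m) ≡⟨ sym (shift-var-≥ (≤-trans (≮⇒≥ n≮c₀) (m≤m+n n d))) ⟩
      shift c₀ m (var (n + d)) ≡⟨ cong (shift c₀ m) (sym (shift-var-≥ (≮⇒≥ n≮c))) ⟩
      shift c₀ m (shift c d (var n)) ∎
  where open ≡-Reasoning
shift-shift {m} (lam y) le eq = cong lam (shift-shift y (s≤s le) (trans (cong suc eq) (sym (+-suc m _))))
shift-shift (app y y₁) le eq = cong₂ app (shift-shift y le eq) (shift-shift y₁ le eq)
shift-shift unit le eq = refl
shift-shift (pair y y₁) le eq = cong₂ pair (shift-shift y le eq) (shift-shift y₁ le eq)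
shift-shift (ft x) le eq = refl
shift-shift (esub y x y₁) le eq = cong₂ (λ a b → esub a x b) (shift-shift y le eq) (shift-shift y₁ le eq)
shift-shift (nt x x₁) le eq = refl

shift-shift-merge : ∀ {k m} a {c' c} → c' ≤ c → c ≤ c' + k → shift c m (shift c' k a) ≡ shift c' (k + m) a
shift-shift-merge {k} {m} (var n) {c'} {c} l1 l2 with n <? c'
... | yes p = trans (cong (shift c m) (shift-var-< p)) (trans (shift-var-< (≤-trans p l1)) (sym (shift-var-< p)))
... | no p = trans (cong (shift c m) (shift-var-≥ (≮⇒≥ p)))
               (trans (shift-var-≥ (≤-trans l2 (+-monoˡ-≤ k (≮⇒≥ p))))
                 (trans (cong var (+-assoc n k m)) (sym (shift-var-≥ (≮⇒≥ p)))))
shift-shift-merge (lam a) l1 l2 = cong lam (shift-shift-merge a (s≤s l1) (s≤s l2))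
shift-shift-merge (app a a₁) l1 l2 = cong₂ app (shift-shift-merge a l1 l2) (shift-shift-merge a₁ l1 l2)
shift-shift-merge unit l1 l2 = refl
shift-shift-merge (pair a a₁) l1 l2 = cong₂ pair (shift-shift-merge a l1 l2) (shift-shift-merge a₁ l1 l2)
shift-shift-merge (ft x) l1 l2 = refl
shift-shift-merge (esub a x a₁) l1 l2 = cong₂ (λ u v → esub u x v) (shift-shift-merge a l1 l2) (shift-shift-merge a₁ l1 l2)
shift-shift-merge (nt x x₁) l1 l2 = refl

substAt-shift : ∀ {m a} y {c₀ k} → c₀ ≤ k → substAt (k + m) a (shift c₀ m y) ≡ shift c₀ m (substAt k a y)
substAt-shift {m} {a} (var n) {c₀} {k} le with n <? c₀
... | yes p = trans (cong (substAt (k + m) a) (shift-var-< p))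
               (trans (substAt-var-< {a = a} (≤-trans p (≤-trans le (m≤m+n k m))))
                 (sym (trans (cong (shift c₀ m) (substAt-var-< {a = a} (≤-trans p le))) (shift-var-< p))))
... | no p with <-cmp n k
...   | tri< n<k _ _ = trans (cong (substAt (k + m) a) (shift-var-≥ (≮⇒≥ p)))
               (trans (substAt-var-< {a = a} (+-monoˡ-< m n<k))
                 (sym (trans (cong (shift c₀ m) (substAt-var-< {a = a} n<k)) (shift-var-≥ (≮⇒≥ p)))))
...   | tri≈ _ refl _ = trans (cong (substAt (k + m) a) (shift-var-≥ (≮⇒≥ p)))
               (trans (substAt-var-≡ {k + m} {a}) (sym (trans (cong (shift c₀ m) (substAt-var-≡ {k} {a})) (shift-shift-merge a z≤n le))))
...   | tri> _ _ k<n = trans (cong (substAt (k + m) a) (shift-var-≥ (≮⇒≥ p)))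
               (trans (substAt-var-> {a = a} (+-monoˡ-< m k<n))
                 (sym (trans (cong (shift c₀ m) (substAt-var-> {a = a} k<n))
                   (trans (shift-var-≥ (suc[m]≤n⇒m≤pred[n] (≤-trans (s≤s le) k<n))) (cong var (pred-+ n k<n))))))
  where
    pred-+ : ∀ n → k < n → pred n + m ≡ pred (n + m)
    pred-+ (suc n) _ = refl
substAt-shift (lam y) le = cong lam (substAt-shift y (s≤s le))
substAt-shift (app y y₁) le = cong₂ app (substAt-shift y le) (substAt-shift y₁ le)
substAt-shift unit le = refl
substAt-shift (pair y y₁) le = cong₂ pair (substAt-shift y le) (substAt-shift y₁ le)
substAt-shift (ft x) le = refl
substAt-shift (esub y x y₁) le = cong₂ (λ u v → esub u x v) (substAt-shift y le) (substAt-shift y₁ le)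
substAt-shift (nt x x₁) le = refl

shift-substAt : ∀ {c d a} t {k} → shift (k + c) d (substAt k a t) ≡ substAt k (shift c d a) (shift (suc k + c) d t)
shift-substAt {c} {d} {a} (var n) {k} with <-cmp n k
... | tri< n<k _ _ = trans (cong (shift (k + c) d) (substAt-var-< {a = a} n<k))
        (trans (shift-var-< (≤-trans n<k (m≤m+n k c)))
          (sym (trans (cong (substAt k (shift c d a)) (shift-var-< (≤-trans (m≤n⇒m≤1+n n<k) (m≤m+n (suc k) c)))) (substAt-var-< {a = shift c d a} n<k))))
... | tri≈ _ refl _ = trans (cong (shift (k + c) d) (substAt-var-≡ {k} {a}))
        (trans (shift-shift {k} {d} a z≤n refl)
          (sym (trans (cong (substAt k (shift c d a)) (shift-var-< (s≤s (m≤m+n k c)))) (substAt-var-≡ {k} {shift c d a}))))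
... | tri> _ _ k<n with n <? suc k + c
...   | yes p = trans (cong (shift (k + c) d) (substAt-var-> {a = a} k<n))
        (trans (shift-var-< (pred-< n p k<n))
          (sym (trans (cong (substAt k (shift c d a)) (shift-var-< p)) (substAt-var-> {a = shift c d a} k<n))))
  where
    pred-< : ∀ n → n < suc k + c → k < n → pred n < k + c
    pred-< (suc n) (s≤s q) _ = q
... | no p = trans (cong (shift (k + c) d) (substAt-var-> {a = a} k<n))
        (trans (shift-var-≥ (suc[m]≤n⇒m≤pred[n] (≮⇒≥ p)))
          (sym (trans (cong (substAt k (shift c d a)) (shift-var-≥ (≮⇒≥ p)))
            (trans (substAt-var-> {a = shift c d a} (≤-trans k<n (m≤m+n n d))) (cong var (pred-+ n k<n))))))
  where
    pred-+ : ∀ n → k < n → pred (n + d) ≡ pred n + d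
    pred-+ (suc n) _ = refl
shift-substAt (lam t) = cong lam (shift-substAt t)
shift-substAt (app t t₁) = cong₂ app (shift-substAt t) (shift-substAt t₁)
shift-substAt unit = refl
shift-substAt (pair t t₁) = cong₂ pair (shift-substAt t) (shift-substAt t₁)
shift-substAt (ft x) = refl
shift-substAt (esub t x t₁) = cong₂ (λ u v → esub u x v) (shift-substAt t) (shift-substAt t₁)
shift-substAt (nt x x₁) = refl

-- Productions commute with shifting and substitution

module Homomorphism (f : ℕ → Tm → Tm)
  (f-lam : ∀ k b → f k (lam b) ≡ lam (f (suc k) b))
  (f-app : ∀ k s t → f k (app s t) ≡ app (f k s) (f k t))
  (f-pair : ∀ k s t → f k (pair s t) ≡ pair (f k s) (f k t))
  (f-esub : ∀ k s α t → f k (esub s α t) ≡ esub (f k s) α (f k t))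
  (f-unit : ∀ k → f k unit ≡ unit)
  (f-ft : ∀ k r → f k (ft r) ≡ ft r)
  (f-nt : ∀ k ρ i → f k (nt ρ i) ≡ nt ρ i)
  (f-var< : ∀ k n → n < k → f k (var n) ≡ var n)
  (f-sh : ∀ m k y → f (m + k) (shift 0 m y) ≡ shift 0 m (f k y))
  where

  f-apps : ∀ k h as → f k (apps h as) ≡ apps (f k h) (map (f k) as)
  f-apps k h [] = refl
  f-apps k h (x ∷ as) = trans (f-apps k (app h x) as) (cong (λ u → apps u (map (f k) as)) (f-app k h x))

  f-lamN : ∀ k m X → f k (lamN m X) ≡ lamN m (f (m + k) X)
  f-lamN k zero X = refl
  f-lamN k (suc m) X = trans (f-lam k (lamN m X)) (cong lam (trans (f-lamN (suc k) m X) (cong (λ j → lamN m (f j X)) (+-suc m k))))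

  f-seqT : ∀ k xs → f k (seqT xs) ≡ seqT (map (f k) xs)
  f-seqT k [] = f-unit k
  f-seqT k (x ∷ xs) = trans (f-pair k x (seqT xs)) (cong (pair (f k x)) (f-seqT k xs))

  f-vars : ∀ k m → m ≤ k → f k (vars m) ≡ vars m
  f-vars k zero _ = f-unit k
  f-vars k (suc m) le = trans (f-pair k (var m) (vars m)) (cong₂ pair (f-var< k m le) (f-vars k m (≤-trans (n≤1+n m) le)))

  f-dot : ∀ k F z r → f k (dot F z r) ≡ dot F (f k z) r
  f-dot k F z r with qf (stripEx F)
  ... | true = refl
  ... | false = trans (f-app k z (ft r)) (cong (app (f k z)) (f-ft k r))

  f-mapsh : ∀ m k xs → map (f (m + k)) (map (shift 0 m) xs) ≡ map (shift 0 m) (map (f k) xs)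
  f-mapsh m k [] = refl
  f-mapsh m k (x ∷ xs) = cong₂ _∷_ (f-sh m k x) (f-mapsh m k xs)

  f-abstraction : ∀ k m θ xs → f k (lamN m (apps (nt θ 0) (vars m ∷ map (shift 0 m) xs)))
               ≡ lamN m (apps (nt θ 0) (vars m ∷ map (shift 0 m) (map (f k) xs)))
  f-abstraction k m θ xs = trans (f-lamN k m (apps (nt θ 0) (vars m ∷ map (shift 0 m) xs))) (cong (lamN m)
     (trans (f-apps (m + k) (nt θ 0) (vars m ∷ map (shift 0 m) xs)) (cong₂ apps (f-nt (m + k) θ 0)
        (cong₂ _∷_ (f-vars (m + k) m (m≤m+n m k)) (f-mapsh m k xs)))))

  f-apps-nt : ∀ k ρ i as → f k (apps (nt ρ i) as) ≡ apps (nt ρ i) (map (f k) as)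
  f-apps-nt k ρ i as = trans (f-apps k (nt ρ i) as) (cong (λ h → apps h (map (f k) as)) (f-nt k ρ i))

  f-apps-nt-∷ : ∀ k ρ i a as {a'} → f k a ≡ a' → f k (apps (nt ρ i) (a ∷ as)) ≡ apps (nt ρ i) (a' ∷ map (f k) as)
  f-apps-nt-∷ k ρ i a as refl = f-apps-nt k ρ i (a ∷ as)

  f-circ : ∀ k F θ₀ θ₁ xs ys → f k (circ F θ₀ θ₁ xs ys) ≡ circ F θ₀ θ₁ (map (f k) xs) (map (f k) ys)
  f-circ k (posF x x₁) θ₀ θ₁ xs ys = f-unit k
  f-circ k (negF x x₁) θ₀ θ₁ xs ys = f-unit k
  f-circ k (andF F F₁) θ₀ θ₁ xs ys = f-unit k
  f-circ k (orF F F₁) θ₀ θ₁ xs ys = f-unit k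
  f-circ k (allF F) θ₀ θ₁ xs ys with qf (stripAll F)
  ... | true = f-unit k
  ... | false = f-abstraction k (leadAll (allF F)) θ₀ xs
  f-circ k (exF F) θ₀ θ₁ xs ys with qf (stripEx F)
  ... | true = f-apps-nt-∷ k θ₀ 0 unit xs (f-unit k)
  ... | false = f-apps-nt-∷ k θ₀ 0 _ xs (f-abstraction k (leadEx (exF F)) θ₁ ys)

  Prod-map : ∀ {c ρ i as r} k → Prod c ρ i as r → Prod c ρ i (map (f k) as) (f k r)
  Prod-map k ax0 = ax0
  Prod-map k ax1 = ax1
  Prod-map {c} k (or0 {ρ} {z} {ys}) = subst (Prod c _ _ _) (sym (f-apps-nt k ρ 0 (z ∷ z ∷ ys))) or0
  Prod-map {c} k (or1 {ρ} {z} {ys}) = subst (Prod c _ _ _) (sym (f-apps-nt k ρ 1 (z ∷ z ∷ ys))) or1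
  Prod-map {c} k (orS {ρ} {i} {z} {ys}) = subst (Prod c _ _ _) (sym (f-apps-nt k ρ _ (z ∷ z ∷ ys))) orS
  Prod-map {c} k (andP₀ {ρ₀} {ρ₁} {i} {zs}) = subst (Prod c _ _ _) (sym (f-apps-nt k ρ₀ i zs)) andP₀
  Prod-map {c} k (andP₁ {ρ₀} {ρ₁} {i} {zs}) = subst (Prod c _ _ _) (sym (f-apps-nt k ρ₁ i zs)) andP₁
  Prod-map {c} k (allP {α} {A} {ρ} {i} {z₀} {z₁} {ys}) =
    subst₂ (Prod c _ _) (cong (_∷ map (f k) ys) (sym (f-pair k z₀ z₁)))
      (sym (trans (f-esub k _ α z₀) (cong (λ u → esub u α (f k z₀)) (f-apps-nt k ρ i (z₁ ∷ ys))))) allP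
  Prod-map {c} k (ex0 {A} {r} {ρ} {z} {ys}) =
    subst (Prod c _ _ _) (sym (trans (f-pair k _ _) (cong₂ pair (f-ft k r)
      (f-apps-nt-∷ k ρ 0 (dot (exF A) z r) ys (f-dot k (exF A) z r))))) ex0
  Prod-map {c} k (exS {A} {r} {ρ} {i} {z} {ys}) = subst (Prod c _ _ _) (sym (f-apps-nt-∷ k ρ (suc i) (dot (exF A) z r) ys (f-dot k (exF A) z r))) exS
  Prod-map {c} k (cutL {A} {ρ₀} {ρ₁} {i} {xs} {ys} e lt) =
    subst₂ (Prod c _ i) (sym (map-++ (f k) xs ys))
      (sym (f-apps-nt-∷ k ρ₀ (suc i) _ xs (f-circ k (dual A) ρ₁ ρ₀ ys xs)))
      (cutL {xs = map (f k) xs} {ys = map (f k) ys} (trans (length-map (f k) xs) e) (subst (i <_) (sym (length-map (f k) xs)) lt))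
  Prod-map {c} k (cutR {A} {ρ₀} {ρ₁} {i} {xs} {ys} e le) =
    subst₂ (Prod c _ i) (sym (map-++ (f k) xs ys))
      (sym (trans (f-apps-nt k ρ₁ (suc (i ∸ length xs)) (circ A ρ₀ ρ₁ xs ys ∷ ys))
        (cong₂ (λ j u → apps (nt ρ₁ (suc (i ∸ j))) (u ∷ map (f k) ys)) (sym (length-map (f k) xs)) (f-circ k A ρ₀ ρ₁ xs ys))))
      (cutR {xs = map (f k) xs} {ys = map (f k) ys} (trans (length-map (f k) xs) e) (subst (_≤ i) (sym (length-map (f k) xs)) le))
  Prod-map {c} k (weak0 {A} {ρ} {z} {ys}) =
    subst (Prod c _ _ _) (sym (trans (f-seqT k (replicate (numEx A) (ft (fn c [])))) (cong seqT (trans (map-replicate (f k) (numEx A) _) (cong (replicate (numEx A)) (f-ft k _)))))) weak0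
  Prod-map {c} k (weakS {A} {ρ} {i} {z} {ys}) = subst (Prod c _ _ _) (sym (f-apps-nt k ρ i ys)) weakS
  Prod-map {c} k (contr0 {ρ} {z} {ys}) = subst (Prod c _ _ _) (sym (f-apps-nt k ρ 0 (z ∷ z ∷ ys))) contr0
  Prod-map {c} k (contr1 {ρ} {z} {ys}) = subst (Prod c _ _ _) (sym (f-apps-nt k ρ 1 (z ∷ z ∷ ys))) contr1
  Prod-map {c} k (contrS {ρ} {i} {z} {ys}) = subst (Prod c _ _ _) (sym (f-apps-nt k ρ _ (z ∷ z ∷ ys))) contrS
  Prod-map {c} k (permP {kk} {ρ} {i} {xs} {z₀} {z₁} {ys} e) =
    subst₂ (Prod c _ i) (sym (map-++ (f k) xs (z₀ ∷ z₁ ∷ ys)))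
      (sym (trans (f-apps-nt k ρ (swapIdx kk i) (xs ++ z₁ ∷ z₀ ∷ ys)) (cong (apps (nt ρ (swapIdx kk i))) (map-++ (f k) xs (z₁ ∷ z₀ ∷ ys)))))
      (permP {xs = map (f k) xs} {z₀ = f k z₀} {z₁ = f k z₁} {ys = map (f k) ys} (trans (length-map (f k) xs) e))

module ShiftHom (d : ℕ) = Homomorphism (λ c t → shift c d t) (λ _ _ → refl) (λ _ _ _ → refl) (λ _ _ _ → refl)
  (λ _ _ _ _ → refl) (λ _ → refl) (λ _ _ → refl) (λ _ _ _ → refl) (λ k n p → shift-var-< p)
  (λ m c y → shift-shift y z≤n refl)

module SubstHom (a : Tm) = Homomorphism (λ k t → substAt k a t) (λ _ _ → refl) (λ _ _ _ → refl) (λ _ _ _ → refl)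
  (λ _ _ _ _ → refl) (λ _ → refl) (λ _ _ → refl) (λ _ _ _ → refl) (λ k n p → substAt-var-< {a = a} p)
  (λ m k y → subst (λ j → substAt j a (shift 0 m y) ≡ shift 0 m (substAt k a y)) (+-comm k m) (substAt-shift {m} {a} y z≤n))

-- Application spines

apps-snoc : ∀ h xs x → apps h (xs ++ x ∷ []) ≡ app (apps h xs) x
apps-snoc h [] x = refl
apps-snoc h (y ∷ xs) x = apps-snoc (app h y) xs x

data Spine : Tm → Set where
  nt-spine  : ∀ {ρ i} → Spine (nt ρ i)
  app-spine : ∀ {s a} → Spine (app s a)

apps-Spine : ∀ {h} xs → Spine h → Spine (apps h xs)
apps-Spine [] sp = sp
apps-Spine (_ ∷ xs) _ = apps-Spine xs app-spine

apps-nt-Spine : ∀ ρ i xs {t} → apps (nt ρ i) xs ≡ t → Spine t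
apps-nt-Spine ρ i xs refl = apps-Spine xs nt-spine

app-inv : ∀ h xs {s a} → app s a ≡ apps h xs →
          (xs ≡ [] × h ≡ app s a) ⊎ (∃ λ ini → xs ≡ ini ++ a ∷ [] × s ≡ apps h ini)
app-inv h [] e = inj₁ (refl , sym e)
app-inv h (x ∷ xs) {s} {a} e with app-inv (app h x) xs e
... | inj₁ (refl , refl) = inj₂ ([] , refl , refl)
... | inj₂ (ini , refl , e') = inj₂ (x ∷ ini , refl , e')

spine : Tm → Tm × List Tm
spine (app s a) = proj₁ (spine s) , proj₂ (spine s) ++ a ∷ []
spine t = t , []

spine-apps : ∀ h xs → spine (apps h xs) ≡ (proj₁ (spine h) , proj₂ (spine h) ++ xs)
spine-apps h [] = cong (proj₁ (spine h) ,_) (sym (++-identityʳ _))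
spine-apps h (x ∷ xs) = trans (spine-apps (app h x) xs) (cong (proj₁ (spine h) ,_) (++-assoc (proj₂ (spine h)) (x ∷ []) xs))

apps-inj : ∀ {ρ i xs ρ' i' ys} → apps (nt ρ i) xs ≡ apps (nt ρ' i') ys → ρ ≡ ρ' × i ≡ i' × xs ≡ ys
apps-inj {ρ} {i} {xs} {ρ'} {i'} {ys} e with trans (sym (spine-apps (nt ρ i) xs)) (trans (cong spine e) (spine-apps (nt ρ' i') ys))
... | refl = refl , refl , refl

module _ (c : ℕ) where
  -- The index apps (nt ρ i) as of a production redex is not a pattern, so steps are inspected
  -- through this view rather than by matching on Root.
  RootView : Tm → Tm → Set
  RootView t s = (∃₂ λ b a → t ≡ app (lam b) a × s ≡ substAt 0 a b) ⊎
                 (Σ Proof λ ρ → Σ ℕ λ i → Σ (List Tm) λ as → t ≡ apps (nt ρ i) as × i < arity ρ × length as ≡ arity ρ × Prod c ρ i as s)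

  rootView : ∀ {t s} → Root c t s → RootView t s
  rootView beta = inj₁ (_ , _ , refl , refl)
  rootView (prod lt le p) = inj₂ (_ , _ , _ , refl , lt , le , p)

  Root-Spine : ∀ {t w} → Root c t w → Spine t
  Root-Spine beta = app-spine
  Root-Spine (prod {ρ} {i} {as} _ _ _) = apps-nt-Spine ρ i as refl

  Step-shift : ∀ {s t} k d → Step c s t → Step c (shift k d s) (shift k d t)
  Step-shift k d (root (beta {b} {a})) = subst (Step c _) (sym (shift-substAt {k} {d} {a} b {0})) (root beta)
  Step-shift k d (root (prod {ρ} {i} {as} lt le p)) =
    subst (λ u → Step c u _) (sym (ShiftHom.f-apps-nt d k ρ i as))
      (root (prod lt (trans (length-map _ as) le) (ShiftHom.Prod-map d k p)))
  Step-shift k d (lamS st) = lamS (Step-shift (suc k) d st)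
  Step-shift k d (appL st) = appL (Step-shift k d st)
  Step-shift k d (appR st) = appR (Step-shift k d st)
  Step-shift k d (pairL st) = pairL (Step-shift k d st)
  Step-shift k d (pairR st) = pairR (Step-shift k d st)
  Step-shift k d (esubL st) = esubL (Step-shift k d st)
  Step-shift k d (esubR st) = esubR (Step-shift k d st)

  Derives-shift : ∀ {s t} k d → Derives c s t → Derives c (shift k d s) (shift k d t)
  Derives-shift k d ε = ε
  Derives-shift k d (x ◅ xs) = Step-shift k d x ◅ Derives-shift k d xs

  Derives-pair⁻¹ : ∀ {a b w} → Derives c (pair a b) w → ∃₂ λ a' b' → w ≡ pair a' b' × Derives c a a' × Derives c b b'
  Derives-pair⁻¹ ε = _ , _ , refl , ε , ε
  Derives-pair⁻¹ (root r ◅ xs) = contradiction (Root-Spine r) λ ()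
  Derives-pair⁻¹ (pairL st ◅ xs) with Derives-pair⁻¹ xs
  ... | a' , b' , refl , p , q = a' , b' , refl , st ◅ p , q
  Derives-pair⁻¹ (pairR st ◅ xs) with Derives-pair⁻¹ xs
  ... | a' , b' , refl , p , q = a' , b' , refl , p , st ◅ q

module Congruence (c : ℕ) (R : Tm → Tm → Set) (rrefl : ∀ t → R t t)
  (rapp : ∀ {a a' b b'} → R a a' → R b b' → R (app a b) (app a' b'))
  (rlam : ∀ {a a'} → R a a' → R (lam a) (lam a'))
  (rpair : ∀ {a a' b b'} → R a a' → R b b' → R (pair a b) (pair a' b'))
  (resub : ∀ {a a' b b' α} → R a a' → R b b' → R (esub a α b) (esub a' α b'))
  (rsh : ∀ k d {a b} → R a b → R (shift k d a) (shift k d b))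
  (rpairInv : ∀ {a b w} → R (pair a b) w → ∃₂ λ a' b' → w ≡ pair a' b' × R a a' × R b b')
  where

  PW = Pointwise R

  pw-refl : ∀ xs → PW xs xs
  pw-refl _ = Pointwise.refl (rrefl _)

  pw-split : ∀ xs {ys zs} → PW (xs ++ ys) zs → ∃₂ λ xs' ys' → zs ≡ xs' ++ ys' × PW xs xs' × PW ys ys'
  pw-split [] p = [] , _ , refl , [] , p
  pw-split (x ∷ xs) (r ∷ p) with pw-split xs p
  ... | xs' , ys' , refl , p1 , p2 = _ ∷ xs' , ys' , refl , r ∷ p1 , p2

  rapps : ∀ {h h' as as'} → R h h' → PW as as' → R (apps h as) (apps h' as')
  rapps rh [] = rh
  rapps rh (r ∷ p) = rapps (rapp rh r) p

  rlamN : ∀ m {a a'} → R a a' → R (lamN m a) (lamN m a')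
  rlamN zero r = r
  rlamN (suc m) r = rlam (rlamN m r)

  pw-sh : ∀ k d {xs xs'} → PW xs xs' → PW (map (shift k d) xs) (map (shift k d) xs')
  pw-sh k d [] = []
  pw-sh k d (r ∷ p) = rsh k d r ∷ pw-sh k d p

  rabstraction : ∀ m θ {xs xs'} → PW xs xs' →
    R (lamN m (apps (nt θ 0) (vars m ∷ map (shift 0 m) xs))) (lamN m (apps (nt θ 0) (vars m ∷ map (shift 0 m) xs')))
  rabstraction m θ p = rlamN m (rapps (rrefl _) (rrefl _ ∷ pw-sh 0 m p))

  rcirc : ∀ F θ₀ θ₁ {xs xs' ys ys'} → PW xs xs' → PW ys ys' → R (circ F θ₀ θ₁ xs ys) (circ F θ₀ θ₁ xs' ys')
  rcirc (posF x x₁) θ₀ θ₁ p q = rrefl _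
  rcirc (negF x x₁) θ₀ θ₁ p q = rrefl _
  rcirc (andF F F₁) θ₀ θ₁ p q = rrefl _
  rcirc (orF F F₁) θ₀ θ₁ p q = rrefl _
  rcirc (allF F) θ₀ θ₁ p q with qf (stripAll F)
  ... | true = rrefl _
  ... | false = rabstraction (leadAll (allF F)) θ₀ p
  rcirc (exF F) θ₀ θ₁ p q with qf (stripEx F)
  ... | true = rapps (rrefl _) (rrefl _ ∷ p)
  ... | false = rapps (rrefl _) (rabstraction (leadEx (exF F)) θ₁ q ∷ p)

  rdot : ∀ F r {z z'} → R z z' → R (dot F z r) (dot F z' r)
  rdot F r p with qf (stripEx F)
  ... | true = p
  ... | false = rapp p (rrefl _)

  Prod-cong : ∀ {ρ i as as' r} → Prod c ρ i as r → PW as as' → ∃ λ r' → Prod c ρ i as' r' × R r r'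
  Prod-cong ax0 (r0 ∷ r1 ∷ []) = _ , ax0 , r1
  Prod-cong ax1 (r0 ∷ r1 ∷ []) = _ , ax1 , r0
  Prod-cong or0 (rz ∷ p) = _ , or0 , rapps (rrefl _) (rz ∷ rz ∷ p)
  Prod-cong or1 (rz ∷ p) = _ , or1 , rapps (rrefl _) (rz ∷ rz ∷ p)
  Prod-cong orS (rz ∷ p) = _ , orS , rapps (rrefl _) (rz ∷ rz ∷ p)
  Prod-cong andP₀ p = _ , andP₀ , rapps (rrefl _) p
  Prod-cong andP₁ p = _ , andP₁ , rapps (rrefl _) p
  Prod-cong allP (rp ∷ p) with rpairInv rp
  ... | a' , b' , refl , r0 , r1 = _ , allP , resub (rapps (rrefl _) (r1 ∷ p)) r0
  Prod-cong (ex0 {A} {r}) (rz ∷ p) = _ , ex0 , rpair (rrefl _) (rapps (rrefl _) (rdot (exF A) r rz ∷ p))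
  Prod-cong (exS {A} {r}) (rz ∷ p) = _ , exS , rapps (rrefl _) (rdot (exF A) r rz ∷ p)
  Prod-cong (cutL {A} {ρ₀} {ρ₁} {i} {xs} e lt) p with pw-split xs p
  ... | xs' , ys' , refl , px , py =
    _ , cutL {xs = xs'} {ys = ys'} (trans (sym (Pointwise-length px)) e) (subst (i <_) (Pointwise-length px) lt) ,
    rapps (rrefl _) (rcirc (dual A) ρ₁ ρ₀ py px ∷ px)
  Prod-cong (cutR {A} {ρ₀} {ρ₁} {i} {xs} e le) p with pw-split xs p
  ... | xs' , ys' , refl , px , py =
    _ , cutR {xs = xs'} {ys = ys'} (trans (sym (Pointwise-length px)) e) (subst (_≤ i) (Pointwise-length px) le) ,
    subst (λ j → R _ (apps (nt ρ₁ (suc (i ∸ j))) (circ A ρ₀ ρ₁ xs' ys' ∷ ys'))) (Pointwise-length px)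
      (rapps (rrefl _) (rcirc A ρ₀ ρ₁ px py ∷ py))
  Prod-cong weak0 (_ ∷ _) = _ , weak0 , rrefl _
  Prod-cong weakS (_ ∷ p) = _ , weakS , rapps (rrefl _) p
  Prod-cong contr0 (rz ∷ p) = _ , contr0 , rapps (rrefl _) (rz ∷ rz ∷ p)
  Prod-cong contr1 (rz ∷ p) = _ , contr1 , rapps (rrefl _) (rz ∷ rz ∷ p)
  Prod-cong contrS (rz ∷ p) = _ , contrS , rapps (rrefl _) (rz ∷ rz ∷ p)
  Prod-cong (permP {k} {ρ} {i} {xs} e) p with pw-split xs p
  ... | xs' , _ , refl , px , (r0 ∷ r1 ∷ py) =
    _ , permP (trans (sym (Pointwise-length px)) e) , rapps (rrefl _) (++⁺ px (r1 ∷ r0 ∷ py))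

module _ (c : ℕ) where
  Derives-app : ∀ {a a' b b'} → Derives c a a' → Derives c b b' → Derives c (app a b) (app a' b')
  Derives-app {a' = a'} {b = b} p q = gmap (λ t → app t b) appL p ◅◅ gmap (app a') appR q
  Derives-lam : ∀ {a a'} → Derives c a a' → Derives c (lam a) (lam a')
  Derives-lam = gmap lam lamS
  Derives-pair : ∀ {a a' b b'} → Derives c a a' → Derives c b b' → Derives c (pair a b) (pair a' b')
  Derives-pair {a' = a'} {b = b} p q = gmap (λ t → pair t b) pairL p ◅◅ gmap (pair a') pairR q
  Derives-esub : ∀ {a a' b b' α} → Derives c a a' → Derives c b b' → Derives c (esub a α b) (esub a' α b')
  Derives-esub {a' = a'} {b = b} {α = α} p q = gmap (λ t → esub t α b) esubL p ◅◅ gmap (esub a' α) esubR q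

  module DerivesCong = Congruence c (Derives c) (λ _ → ε) Derives-app Derives-lam Derives-pair Derives-esub (λ k d p → Derives-shift c k d p) (Derives-pair⁻¹ c)

-- Parallel unfolding of cut and permutation non-terminals

++-injective : ∀ {A : Set} (xs xs' : List A) {ys ys'} → length xs ≡ length xs' → xs ++ ys ≡ xs' ++ ys' → xs ≡ xs' × ys ≡ ys'
++-injective [] [] _ e = refl , e
++-injective (x ∷ xs) (x' ∷ xs') l e with ∷-injective e
... | refl , e' with ++-injective xs xs' (suc-injective l) e'
... | refl , refl = refl , refl

data Deterministic : Proof → Set where
  dcut  : ∀ {A ρ₀ ρ₁} → Deterministic (cut A ρ₀ ρ₁)
  dperm : ∀ {k ρ} → Deterministic (perm k ρ)

-- As for RootView: two cut productions for the same arguments are compared through a view,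
-- since their argument lists xs ++ ys cannot be unified by matching.
CutView : Formula → Proof → Proof → ℕ → List Tm → Tm → Set
CutView A ρ₀ ρ₁ i as r = Σ (List Tm) λ xs → Σ (List Tm) λ ys → as ≡ xs ++ ys × length xs ≡ pred (arity ρ₀) ×
   ((i < length xs × r ≡ apps (nt ρ₀ (suc i)) (circ (dual A) ρ₁ ρ₀ ys xs ∷ xs)) ⊎
    (length xs ≤ i × r ≡ apps (nt ρ₁ (suc (i ∸ length xs))) (circ A ρ₀ ρ₁ xs ys ∷ ys)))

module _ (c : ℕ) where

  cutView : ∀ {A ρ₀ ρ₁ i as r} → Prod c (cut A ρ₀ ρ₁) i as r → CutView A ρ₀ ρ₁ i as r
  cutView (cutL {xs = xs} {ys = ys} e lt) = xs , ys , refl , e , inj₁ (lt , refl)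
  cutView (cutR {xs = xs} {ys = ys} e le) = xs , ys , refl , e , inj₂ (le , refl)

  permView : ∀ {k ρ i as r} → Prod c (perm k ρ) i as r →
    Σ (List Tm) λ xs → Σ Tm λ z₀ → Σ Tm λ z₁ → Σ (List Tm) λ ys →
      as ≡ xs ++ z₀ ∷ z₁ ∷ ys × length xs ≡ k × r ≡ apps (nt ρ (swapIdx k i)) (xs ++ z₁ ∷ z₀ ∷ ys)
  permView (permP {xs = xs} {z₀} {z₁} {ys} e) = xs , z₀ , z₁ , ys , refl , e , refl

  Prod-unique : ∀ {ρ i as r r'} → Deterministic ρ → Prod c ρ i as r → Prod c ρ i as r' → r ≡ r'
  Prod-unique dcut p q with cutView p | cutView q
  ... | xs , ys , refl , l1 , v1 | xs' , ys' , e , l2 , v2 with ++-injective xs xs' (trans l1 (sym l2)) e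
  ... | refl , refl with v1 | v2
  ... | inj₁ (_ , refl) | inj₁ (_ , refl) = refl
  ... | inj₂ (_ , refl) | inj₂ (_ , refl) = refl
  ... | inj₁ (lt , _) | inj₂ (le , _) = ⊥-elim (<⇒≱ lt le)
  ... | inj₂ (le , _) | inj₁ (lt , _) = ⊥-elim (<⇒≱ lt le)
  Prod-unique dperm p q with permView p | permView q
  ... | xs , z₀ , z₁ , ys , refl , l1 , refl | xs' , z₀' , z₁' , ys' , e , l2 , refl with ++-injective xs xs' (trans l1 (sym l2)) e
  ... | refl , refl = refl

  -- One step of parallel unfolding: a congruence that may also fire, on already unfolded
  -- arguments, the unique production of a fully applied cut or permutation non-terminal.
  infix 4 _⇛_
  data _⇛_ : Tm → Tm → Set where
    pvar  : ∀ {n} → var n ⇛ var n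
    punit : unit ⇛ unit
    pft   : ∀ {r} → ft r ⇛ ft r
    pnt   : ∀ {ρ i} → nt ρ i ⇛ nt ρ i
    plam  : ∀ {s t} → s ⇛ t → lam s ⇛ lam t
    papp  : ∀ {s s' t t'} → s ⇛ s' → t ⇛ t' → app s t ⇛ app s' t'
    ppair : ∀ {s s' t t'} → s ⇛ s' → t ⇛ t' → pair s t ⇛ pair s' t'
    pesub : ∀ {s s' t t' α} → s ⇛ s' → t ⇛ t' → esub s α t ⇛ esub s' α t'
    pdev  : ∀ {ρ i as as' r} → Deterministic ρ → i < arity ρ → length as ≡ arity ρ →
            Pointwise _⇛_ as as' → Prod c ρ i as' r → apps (nt ρ i) as ⇛ r

  ⇛-refl : ∀ t → t ⇛ t
  ⇛-refl (var x) = pvar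
  ⇛-refl (lam t) = plam (⇛-refl t)
  ⇛-refl (app t t₁) = papp (⇛-refl t) (⇛-refl t₁)
  ⇛-refl unit = punit
  ⇛-refl (pair t t₁) = ppair (⇛-refl t) (⇛-refl t₁)
  ⇛-refl (ft x) = pft
  ⇛-refl (esub t x t₁) = pesub (⇛-refl t) (⇛-refl t₁)
  ⇛-refl (nt x x₁) = pnt

  mutual
    ⇛-shift : ∀ k d {s t} → s ⇛ t → shift k d s ⇛ shift k d t
    ⇛-shift k d pvar = ⇛-refl _
    ⇛-shift k d punit = punit
    ⇛-shift k d pft = pft
    ⇛-shift k d pnt = pnt
    ⇛-shift k d (plam p) = plam (⇛-shift (suc k) d p)
    ⇛-shift k d (papp p q) = papp (⇛-shift k d p) (⇛-shift k d q)
    ⇛-shift k d (ppair p q) = ppair (⇛-shift k d p) (⇛-shift k d q)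
    ⇛-shift k d (pesub p q) = pesub (⇛-shift k d p) (⇛-shift k d q)
    ⇛-shift k d (pdev {ρ} {i} {as} dt lt le pw pr) =
      subst (_⇛ _) (sym (ShiftHom.f-apps-nt d k ρ i as))
        (pdev dt lt (trans (length-map _ as) le) (pw-shift k d pw) (ShiftHom.Prod-map d k pr))

    pw-shift : ∀ k d {as as'} → Pointwise _⇛_ as as' → Pointwise _⇛_ (map (shift k d) as) (map (shift k d) as')
    pw-shift k d [] = []
    pw-shift k d (p ∷ ps) = ⇛-shift k d p ∷ pw-shift k d ps

  mutual
    ⇛-substAt : ∀ k {a a' s t} → a ⇛ a' → s ⇛ t → substAt k a s ⇛ substAt k a' t
    ⇛-substAt k {a} {a'} pa (pvar {n}) with <-cmp n k
    ... | tri< lt _ _ = subst₂ _⇛_ (sym (substAt-var-< {a = a} lt)) (sym (substAt-var-< {a = a'} lt)) pvar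
    ... | tri≈ _ refl _ = subst₂ _⇛_ (sym (substAt-var-≡ {n} {a})) (sym (substAt-var-≡ {n} {a'})) (⇛-shift 0 n pa)
    ... | tri> _ _ gt = subst₂ _⇛_ (sym (substAt-var-> {a = a} gt)) (sym (substAt-var-> {a = a'} gt)) pvar
    ⇛-substAt k pa punit = punit
    ⇛-substAt k pa pft = pft
    ⇛-substAt k pa pnt = pnt
    ⇛-substAt k pa (plam p) = plam (⇛-substAt (suc k) pa p)
    ⇛-substAt k pa (papp p q) = papp (⇛-substAt k pa p) (⇛-substAt k pa q)
    ⇛-substAt k pa (ppair p q) = ppair (⇛-substAt k pa p) (⇛-substAt k pa q)
    ⇛-substAt k pa (pesub p q) = pesub (⇛-substAt k pa p) (⇛-substAt k pa q)
    ⇛-substAt k {a} {a'} pa (pdev {ρ} {i} {as} dt lt le pw pr) =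
      subst (_⇛ _) (sym (SubstHom.f-apps-nt a k ρ i as))
        (pdev dt lt (trans (length-map _ as) le) (pw-substAt k pa pw) (SubstHom.Prod-map a' k pr))

    pw-substAt : ∀ k {a a' as as'} → a ⇛ a' → Pointwise _⇛_ as as' → Pointwise _⇛_ (map (substAt k a) as) (map (substAt k a') as')
    pw-substAt k pa [] = []
    pw-substAt k pa (p ∷ ps) = ⇛-substAt k pa p ∷ pw-substAt k pa ps

  ⇛-pair⁻¹ : ∀ {t w a b} → t ⇛ w → t ≡ pair a b → ∃₂ λ a' b' → w ≡ pair a' b' × a ⇛ a' × b ⇛ b'
  ⇛-pair⁻¹ (ppair p q) refl = _ , _ , refl , p , q
  ⇛-pair⁻¹ (pdev {ρ} {i} {as} _ _ _ _ _) e = contradiction (apps-nt-Spine ρ i as e) λ ()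
  ⇛-pair⁻¹ pvar ()
  ⇛-pair⁻¹ punit ()
  ⇛-pair⁻¹ pft ()
  ⇛-pair⁻¹ pnt ()
  ⇛-pair⁻¹ (plam _) ()
  ⇛-pair⁻¹ (papp _ _) ()
  ⇛-pair⁻¹ (pesub _ _) ()

  ⇛-lam⁻¹ : ∀ {t w b} → t ⇛ w → t ≡ lam b → ∃ λ b' → w ≡ lam b' × b ⇛ b'
  ⇛-lam⁻¹ (plam p) refl = _ , refl , p
  ⇛-lam⁻¹ (pdev {ρ} {i} {as} _ _ _ _ _) e = contradiction (apps-nt-Spine ρ i as e) λ ()
  ⇛-lam⁻¹ pvar ()
  ⇛-lam⁻¹ punit ()
  ⇛-lam⁻¹ pft ()
  ⇛-lam⁻¹ pnt ()
  ⇛-lam⁻¹ (ppair _ _) ()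
  ⇛-lam⁻¹ (papp _ _) ()
  ⇛-lam⁻¹ (pesub _ _) ()

  module ParCong = Congruence c _⇛_ ⇛-refl papp plam ppair pesub ⇛-shift (λ p → ⇛-pair⁻¹ p refl)

  mutual
    ⇛⇒Derives : ∀ {s t} → s ⇛ t → Derives c s t
    ⇛⇒Derives pvar = ε
    ⇛⇒Derives punit = ε
    ⇛⇒Derives pft = ε
    ⇛⇒Derives pnt = ε
    ⇛⇒Derives (plam p) = Derives-lam c (⇛⇒Derives p)
    ⇛⇒Derives (papp p q) = Derives-app c (⇛⇒Derives p) (⇛⇒Derives q)
    ⇛⇒Derives (ppair p q) = Derives-pair c (⇛⇒Derives p) (⇛⇒Derives q)
    ⇛⇒Derives (pesub p q) = Derives-esub c (⇛⇒Derives p) (⇛⇒Derives q)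
    ⇛⇒Derives (pdev dt lt le pw pr) =
      DerivesCong.rapps c ε (pw⇒Derives pw) ◅◅ (root (prod lt (trans (sym (Pointwise-length pw)) le) pr) ◅ ε)

    pw⇒Derives : ∀ {as as'} → Pointwise _⇛_ as as' → Pointwise (Derives c) as as'
    pw⇒Derives [] = []
    pw⇒Derives (p ∷ ps) = ⇛⇒Derives p ∷ pw⇒Derives ps

module _ (c : ℕ) where

  StepPointwise : List Tm → List Tm → Set
  StepPointwise = Pointwise (λ a b → a ≡ b ⊎ Step c a b)

  length-snoc : ∀ (xs : List Tm) a → length (xs ++ a ∷ []) ≡ suc (length xs)
  length-snoc xs a = trans (length-++ xs) (+-comm (length xs) 1)

  nt-not-redex : ∀ {ρ i ρ' i' as} → nt ρ i ≡ apps (nt ρ' i') as → i' < arity ρ' → length as ≡ arity ρ' → ⊥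
  nt-not-redex {ρ} {i} {ρ'} {i'} {as} e lt le with apps-inj {ρ} {i} {[]} {ρ'} {i'} {as} e
  ... | refl , refl , refl = ⊥-elim (<⇒≱ lt (subst (_≤ _) le z≤n))

  Step-spine : ∀ {t w ρ i xs} → Step c t w → t ≡ apps (nt ρ i) xs → length xs ≤ arity ρ →
       (length xs ≡ arity ρ × Root c t w) ⊎ (∃ λ xs' → w ≡ apps (nt ρ i) xs' × StepPointwise xs xs')
  Step-spine {ρ = ρ} {i} {xs} (root r) e le with length xs ≟ arity ρ
  ... | yes q = inj₁ (q , r)
  ... | no q with rootView c r
  ...   | inj₁ (b , a , refl , _) with app-inv (nt ρ i) xs e
  ...     | inj₁ (_ , ())
  ...     | inj₂ (ini , _ , e2) = contradiction (apps-nt-Spine ρ i ini (sym e2)) λ ()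
  Step-spine {ρ = ρ} {i} {xs} (root r) e le | no q | inj₂ (ρ' , i' , as , refl , lt , le' , _) with apps-inj {ρ'} {i'} {as} {ρ} {i} {xs} e
  ... | refl , refl , refl = ⊥-elim (q le')
  Step-spine {ρ = ρ} {i} {xs} (appL {s} {t} {u} st) e le with app-inv (nt ρ i) xs e
  ... | inj₁ (_ , ())
  ... | inj₂ (ini , refl , e2) with Step-spine {ρ = ρ} {i} {ini} st e2 (≤-trans (n≤1+n _) (subst (_≤ arity ρ) (length-snoc ini u) le))
  ...   | inj₁ (q , _) = ⊥-elim (1+n≰n (subst (_≤ length ini) (length-snoc ini u) (subst (λ z → length (ini ++ u ∷ []) ≤ z) (sym q) le)))
  ...   | inj₂ (ini' , refl , p) = inj₂ (ini' ++ u ∷ [] , sym (apps-snoc (nt ρ i) ini' u) , ++⁺ p (inj₁ refl ∷ []))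
  Step-spine {ρ = ρ} {i} {xs} (appR {s} {t} {u} st) e le with app-inv (nt ρ i) xs e
  ... | inj₁ (_ , ())
  ... | inj₂ (ini , refl , refl) = inj₂ (ini ++ t ∷ [] , sym (apps-snoc (nt ρ i) ini t) , ++⁺ (Pointwise.refl (inj₁ refl)) (inj₂ st ∷ []))
  Step-spine {ρ = ρ} {i} {xs} (lamS st) e le = contradiction (apps-nt-Spine ρ i xs (sym e)) λ ()
  Step-spine {ρ = ρ} {i} {xs} (pairL st) e le = contradiction (apps-nt-Spine ρ i xs (sym e)) λ ()
  Step-spine {ρ = ρ} {i} {xs} (pairR st) e le = contradiction (apps-nt-Spine ρ i xs (sym e)) λ ()
  Step-spine {ρ = ρ} {i} {xs} (esubL st) e le = contradiction (apps-nt-Spine ρ i xs (sym e)) λ ()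
  Step-spine {ρ = ρ} {i} {xs} (esubR st) e le = contradiction (apps-nt-Spine ρ i xs (sym e)) λ ()

  ⇛-spine : ∀ {t v ρ i xs} → _⇛_ c t v → t ≡ apps (nt ρ i) xs → length xs < arity ρ →
             ∃ λ xs' → v ≡ apps (nt ρ i) xs' × Pointwise (_⇛_ c) xs xs'
  ⇛-spine {ρ = ρ} {i} {xs} pnt e lt with apps-inj {_} {_} {[]} {ρ} {i} {xs} e
  ... | refl , refl , refl = [] , refl , []
  ⇛-spine {ρ = ρ} {i} {xs} (papp {s} {s'} {t} {t'} p q) e lt with app-inv (nt ρ i) xs e
  ... | inj₁ (_ , ())
  ... | inj₂ (ini , refl , e2) with ⇛-spine {ρ = ρ} {i} {ini} p e2 (≤-trans (n≤1+n _) (subst (_< arity ρ) (length-snoc ini t) lt))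
  ...   | ini' , refl , pw = ini' ++ t' ∷ [] , sym (apps-snoc (nt ρ i) ini' t') , ++⁺ pw (q ∷ [])
  ⇛-spine {ρ = ρ} {i} {xs} (pdev {ρ'} {i'} {as} _ _ le _ _) e lt with apps-inj {ρ'} {i'} {as} {ρ} {i} {xs} e
  ... | refl , refl , refl = ⊥-elim (<⇒≢ lt le)
  ⇛-spine {ρ = ρ} {i} {xs} pvar e lt = contradiction (apps-nt-Spine ρ i xs (sym e)) λ ()
  ⇛-spine {ρ = ρ} {i} {xs} punit e lt = contradiction (apps-nt-Spine ρ i xs (sym e)) λ ()
  ⇛-spine {ρ = ρ} {i} {xs} pft e lt = contradiction (apps-nt-Spine ρ i xs (sym e)) λ ()
  ⇛-spine {ρ = ρ} {i} {xs} (plam _) e lt = contradiction (apps-nt-Spine ρ i xs (sym e)) λ ()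
  ⇛-spine {ρ = ρ} {i} {xs} (ppair _ _) e lt = contradiction (apps-nt-Spine ρ i xs (sym e)) λ ()
  ⇛-spine {ρ = ρ} {i} {xs} (pesub _ _) e lt = contradiction (apps-nt-Spine ρ i xs (sym e)) λ ()

  app-Root-simulation : ∀ {s s' a a' w} → _⇛_ c s s' → _⇛_ c a a' → Root c (app s a) w →
                        ∃ λ u → Derives c (app s' a') u × _⇛_ c w u
  app-Root-simulation p p' r with rootView c r
  ... | inj₁ (_ , _ , refl , refl) with ⇛-lam⁻¹ c p refl
  ...   | _ , refl , pb = _ , (root beta ◅ ε) , ⇛-substAt c 0 p' pb
  app-Root-simulation {a = a} {a'} p p' r | inj₂ (ρ , i , as , e , lt , le , pr) with app-inv (nt ρ i) as e
  ... | inj₁ (_ , ())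
  ... | inj₂ (ini , refl , e2) with ⇛-spine {ρ = ρ} {i} {ini} p e2 (subst (_≤ arity ρ) (length-snoc ini a) (≤-reflexive le))
  ...   | ini' , refl , pw with ParCong.Prod-cong c pr (++⁺ pw (p' ∷ []))
  ...     | r' , pr' , q =
    r' , (subst (λ z → Derives c z r') (apps-snoc (nt ρ i) ini' a')
           (root (prod lt (trans (sym (Pointwise-length (++⁺ pw (p' ∷ [])))) le) pr') ◅ ε)) , q

  dev-Root-simulation : ∀ {ρ i as as' r w} → Deterministic ρ → Pointwise (_⇛_ c) as as' → Prod c ρ i as' r →
                        Root c (apps (nt ρ i) as) w → _⇛_ c w r
  dev-Root-simulation {ρ} {i} {as} dt pw pr rt with rootView c rt
  ... | inj₁ (_ , _ , e , _) with app-inv (nt ρ i) as (sym e)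
  ...   | inj₁ (_ , ())
  ...   | inj₂ (ini , _ , e2) = contradiction (apps-nt-Spine ρ i ini (sym e2)) λ ()
  dev-Root-simulation {ρ} {i} {as} dt pw pr rt | inj₂ (ρ' , i' , bs , e , _ , _ , pr₀) with apps-inj {ρ} {i} {as} {ρ'} {i'} {bs} e
  ... | refl , refl , refl with ParCong.Prod-cong c pr₀ pw
  ...   | _ , pr'' , q = subst (_⇛_ c _) (sym (Prod-unique c dt pr pr'')) q

  mutual
    ⇛-simulates-Step : ∀ {s u s'} → _⇛_ c s u → Step c s s' → ∃ λ u' → Derives c u u' × _⇛_ c s' u'
    ⇛-simulates-Step pvar (root r) = contradiction (Root-Spine c r) λ ()
    ⇛-simulates-Step punit (root r) = contradiction (Root-Spine c r) λ ()
    ⇛-simulates-Step pft (root r) = contradiction (Root-Spine c r) λ ()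
    ⇛-simulates-Step pnt (root r) with rootView c r
    ... | inj₂ (ρ , i , as , e , lt , le , _) = ⊥-elim (nt-not-redex {ρ' = ρ} {i} {as} e lt le)
    ⇛-simulates-Step (plam p) (root r) = contradiction (Root-Spine c r) λ ()
    ⇛-simulates-Step (plam p) (lamS st) with ⇛-simulates-Step p st
    ... | u' , d , q = lam u' , Derives-lam c d , plam q
    ⇛-simulates-Step (ppair p p') (root r) = contradiction (Root-Spine c r) λ ()
    ⇛-simulates-Step (ppair p p') (pairL st) with ⇛-simulates-Step p st
    ... | u' , d , q = _ , Derives-pair c d ε , ppair q p'
    ⇛-simulates-Step (ppair p p') (pairR st) with ⇛-simulates-Step p' st
    ... | u' , d , q = _ , Derives-pair c ε d , ppair p q
    ⇛-simulates-Step (pesub p p') (root r) = contradiction (Root-Spine c r) λ ()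
    ⇛-simulates-Step (pesub p p') (esubL st) with ⇛-simulates-Step p st
    ... | u' , d , q = _ , Derives-esub c d ε , pesub q p'
    ⇛-simulates-Step (pesub p p') (esubR st) with ⇛-simulates-Step p' st
    ... | u' , d , q = _ , Derives-esub c ε d , pesub p q
    ⇛-simulates-Step (papp p p') (appL st) with ⇛-simulates-Step p st
    ... | u' , d , q = _ , Derives-app c d ε , papp q p'
    ⇛-simulates-Step (papp p p') (appR st) with ⇛-simulates-Step p' st
    ... | u' , d , q = _ , Derives-app c ε d , papp p q
    ⇛-simulates-Step (papp p p') (root r) = app-Root-simulation p p' r
    ⇛-simulates-Step (pdev {ρ} {i} {as} {r = r} dt lt le pw pr) st with Step-spine {ρ = ρ} {i} {as} st refl (≤-reflexive le)
    ... | inj₁ (_ , rt) = r , ε , dev-Root-simulation dt pw pr rt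
    ... | inj₂ (_ , refl , pst) with ⇛-simulates-Step* pw pst
    ...   | _ , pstar , ppar with DerivesCong.Prod-cong c pr pstar
    ...     | r₂ , pr₂ , d = r₂ , d , pdev dt lt (trans (sym (Pointwise-length pst)) le) ppar pr₂

    ⇛-simulates-Step* : ∀ {as as' as₁} → Pointwise (_⇛_ c) as as' → StepPointwise as as₁ →
            ∃ λ bs → Pointwise (Derives c) as' bs × Pointwise (_⇛_ c) as₁ bs
    ⇛-simulates-Step* [] [] = [] , [] , []
    ⇛-simulates-Step* (p ∷ ps) (inj₁ refl ∷ qs) with ⇛-simulates-Step* ps qs
    ... | bs , x , y = _ ∷ bs , ε ∷ x , p ∷ y
    ⇛-simulates-Step* (p ∷ ps) (inj₂ st ∷ qs) with ⇛-simulates-Step p st | ⇛-simulates-Step* ps qs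
    ... | u' , d , q | bs , x , y = u' ∷ bs , d ∷ x , q ∷ y

-- Unfolding preserves the derivable evaluated terms

>>=-just : ∀ {A B : Set} (m : Maybe A) (f : A → Maybe B) {b} → (m >>= f) ≡ just b → ∃ λ a → m ≡ just a × f a ≡ just b
>>=-just (just a) f e = a , refl , e
>>=-just nothing f ()

evalO-Spine : ∀ {t} → Spine t → evalO t ≡ nothing
evalO-Spine nt-spine = refl
evalO-Spine app-spine = refl

evalSeq-Spine : ∀ {t} → Spine t → evalSeq t ≡ nothing
evalSeq-Spine nt-spine = refl
evalSeq-Spine app-spine = refl

module _ (c : ℕ) where

  mutual
    evalO-⇛-stable : ∀ {t u r} → _⇛_ c t u → evalO t ≡ just r → u ≡ t
    evalO-⇛-stable pft e = refl
    evalO-⇛-stable (pesub {s} {s'} {t} {t'} p q) e with >>=-just (evalO s) _ e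
    ... | a , e1 , e2 with >>=-just (evalO t) _ e2
    ...   | b , e3 , _ = cong₂ (λ x y → esub x _ y) (evalO-⇛-stable p e1) (evalO-⇛-stable q e3)
    evalO-⇛-stable (pdev {ρ} {i} {as} _ _ _ _ _) e = contradiction (trans (sym (evalO-Spine (apps-nt-Spine ρ i as refl))) e) λ ()
    evalO-⇛-stable pvar ()
    evalO-⇛-stable punit ()
    evalO-⇛-stable pnt ()
    evalO-⇛-stable (plam _) ()
    evalO-⇛-stable (papp _ _) ()
    evalO-⇛-stable (ppair _ _) ()

    evalSeq-⇛-stable : ∀ {t u r} → _⇛_ c t u → evalSeq t ≡ just r → u ≡ t
    evalSeq-⇛-stable punit e = refl
    evalSeq-⇛-stable (ppair {s} {s'} {t} {t'} p q) e with >>=-just (evalO s) _ e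
    ... | a , e1 , e2 with >>=-just (evalSeq t) _ e2
    ...   | b , e3 , _ = cong₂ pair (evalO-⇛-stable p e1) (evalSeq-⇛-stable q e3)
    evalSeq-⇛-stable (pesub {s} {s'} {t} {t'} p q) e with >>=-just (evalSeq s) _ e
    ... | a , e1 , e2 with >>=-just (evalO t) _ e2
    ...   | b , e3 , _ = cong₂ (λ x y → esub x _ y) (evalSeq-⇛-stable p e1) (evalO-⇛-stable q e3)
    evalSeq-⇛-stable (pdev {ρ} {i} {as} _ _ _ _ _) e = contradiction (trans (sym (evalSeq-Spine (apps-nt-Spine ρ i as refl))) e) λ ()
    evalSeq-⇛-stable pvar ()
    evalSeq-⇛-stable pft ()
    evalSeq-⇛-stable pnt ()
    evalSeq-⇛-stable (plam _) ()
    evalSeq-⇛-stable (papp _ _) ()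

  -- Evaluated terms are fixed by unfolding, so simulation replays a derivation of an
  -- evaluated term from s as a derivation from any unfolding of s.
  ⇛-Derives-value : ∀ {s u T ts} → _⇛_ c s u → Derives c s T → evalSeq T ≡ just ts → Derives c u T
  ⇛-Derives-value p ε e = subst (Derives c _) (evalSeq-⇛-stable p e) ε
  ⇛-Derives-value p (st ◅ ds) e with ⇛-simulates-Step c p st
  ... | u' , d , q = d ◅◅ ⇛-Derives-value q ds e

  _≈_ : Tm → Tm → Set
  _≈_ = EqClosure (_⇛_ c)

  ≈-sym : ∀ {a b} → a ≈ b → b ≈ a
  ≈-sym = EqClosure.symmetric (_⇛_ c)

  ≈-Derives-value : ∀ {s u T ts} → s ≈ u → Derives c s T → evalSeq T ≡ just ts → Derives c u T
  ≈-Derives-value ε d e = d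
  ≈-Derives-value (fwd x ◅ p) d e = ≈-Derives-value p (⇛-Derives-value x d e) e
  ≈-Derives-value (bwd x ◅ p) d e = ≈-Derives-value p (⇛⇒Derives c x ◅◅ d) e

  ⇛⇒≈ : ∀ {a b} → _⇛_ c a b → a ≈ b
  ⇛⇒≈ x = fwd x ◅ ε

  ⇚⇒≈ : ∀ {a b} → _⇛_ c b a → a ≈ b
  ⇚⇒≈ x = bwd x ◅ ε

  ≡⇒≈ : ∀ {a b} → a ≡ b → a ≈ b
  ≡⇒≈ refl = ε

  ≈-cong : (C : Tm → Tm) → (∀ {a b} → _⇛_ c a b → _⇛_ c (C a) (C b)) → ∀ {a b} → a ≈ b → C a ≈ C b
  ≈-cong C f = EqClosure.gmap C f

  ≈-arg₁ : ∀ ρ j {b b'} xs → b ≈ b' → apps (nt ρ j) (b ∷ xs) ≈ apps (nt ρ j) (b' ∷ xs)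
  ≈-arg₁ ρ j xs = ≈-cong (λ z → apps (nt ρ j) (z ∷ xs)) (λ d → ParCong.rapps c pnt (d ∷ ParCong.pw-refl c xs))

  ≈-arg₂ : ∀ ρ j a {b b'} xs → b ≈ b' → apps (nt ρ j) (a ∷ b ∷ xs) ≈ apps (nt ρ j) (a ∷ b' ∷ xs)
  ≈-arg₂ ρ j a xs = ≈-cong (λ z → apps (nt ρ j) (a ∷ z ∷ xs)) (λ d → ParCong.rapps c pnt (⇛-refl c a ∷ d ∷ ParCong.pw-refl c xs))

  L-≈ : ∀ {π π'} Θ → (∀ i → i < length Θ → apps (nt π i) (replicate (length Θ) unit) ≈ apps (nt π' i) (replicate (length Θ) unit)) →
        ∀ p → L c π Θ p ⇔ L c π' Θ p
  L-≈ Θ π≈π' (i , _) = mk⇔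
    (λ (lt , T , d , e , le) → lt , T , ≈-Derives-value (π≈π' i lt) d e , e , le)
    (λ (lt , T , d , e , le) → lt , T , ≈-Derives-value (≈-sym (π≈π' i lt)) d e , e , le)

-- ∘-terms, and cut formulas in Σ2

dual-exN : ∀ m X → dual (exN m X) ≡ allN m (dual X)
dual-exN zero X = refl
dual-exN (suc m) X = cong allF (dual-exN m X)

dual-allN : ∀ m X → dual (allN m X) ≡ exN m (dual X)
dual-allN zero X = refl
dual-allN (suc m) X = cong exF (dual-allN m X)

QF-dual : ∀ {X} → QF X → QF (dual X)
QF-dual posQ = negQ
QF-dual negQ = posQ
QF-dual (andQ p q) = orQ (QF-dual p) (QF-dual q)
QF-dual (orQ p q) = andQ (QF-dual p) (QF-dual q)

qf-QF : ∀ {X} → QF X → qf X ≡ true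
qf-QF posQ = refl
qf-QF negQ = refl
qf-QF (andQ p q) rewrite qf-QF p | qf-QF q = refl
qf-QF (orQ p q) rewrite qf-QF p | qf-QF q = refl

stripEx-QF : ∀ {X} → QF X → stripEx X ≡ X
stripEx-QF posQ = refl
stripEx-QF negQ = refl
stripEx-QF (andQ p q) = refl
stripEx-QF (orQ p q) = refl

stripAll-QF : ∀ {X} → QF X → stripAll X ≡ X
stripAll-QF posQ = refl
stripAll-QF negQ = refl
stripAll-QF (andQ p q) = refl
stripAll-QF (orQ p q) = refl

stripEx-exN : ∀ n X → stripEx (exN n X) ≡ stripEx X
stripEx-exN zero X = refl
stripEx-exN (suc n) X = stripEx-exN n X

stripAll-allN : ∀ n X → stripAll (allN n X) ≡ stripAll X
stripAll-allN zero X = refl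
stripAll-allN (suc n) X = stripAll-allN n X

qf-dual : ∀ X → qf (dual X) ≡ qf X
qf-dual (posF x x₁) = refl
qf-dual (negF x x₁) = refl
qf-dual (andF X Y) rewrite qf-dual X | qf-dual Y = refl
qf-dual (orF X Y) rewrite qf-dual X | qf-dual Y = refl
qf-dual (allF X) = refl
qf-dual (exF X) = refl

stripAll-dual : ∀ Y → stripAll (dual Y) ≡ dual (stripEx Y)
stripAll-dual (posF x x₁) = refl
stripAll-dual (negF x x₁) = refl
stripAll-dual (andF Y Y₁) = refl
stripAll-dual (orF Y Y₁) = refl
stripAll-dual (allF Y) = refl
stripAll-dual (exF Y) = stripAll-dual Y

leadAll-dual : ∀ Y → leadAll (dual Y) ≡ leadEx Y
leadAll-dual (posF x x₁) = refl
leadAll-dual (negF x x₁) = refl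
leadAll-dual (andF Y Y₁) = refl
leadAll-dual (orF Y Y₁) = refl
leadAll-dual (allF Y) = refl
leadAll-dual (exF Y) = cong suc (leadAll-dual Y)

circ-ex : ∀ Y θ₀ θ₁ xs ys → circ (exF Y) θ₀ θ₁ xs ys ≡ apps (nt θ₀ 0) (circ (dual (exF Y)) θ₁ θ₀ ys xs ∷ xs)
circ-ex Y θ₀ θ₁ xs ys with trans (cong qf (stripAll-dual Y)) (qf-dual (stripEx Y)) | leadAll-dual Y
... | e1 | e2 rewrite e1 | e2 with qf (stripEx Y)
... | true = refl
... | false = refl

circ-dual∃-indep : ∀ {X Y} → X ≡ exF Y → ∀ θ₀ θ₁ θ₁' xs ys ys' → circ (dual X) θ₀ θ₁ xs ys ≡ circ (dual X) θ₀ θ₁' xs ys'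
circ-dual∃-indep refl θ₀ θ₁ θ₁' xs ys ys' = refl

circ-dualΣ2-indep : ∀ {F} → IsΣ2 F → ∀ θ₀ θ₁ θ₁' xs ys ys' → circ (dual F) θ₀ θ₁ xs ys ≡ circ (dual F) θ₀ θ₁' xs ys'
circ-dualΣ2-indep (m , n , G0 , q , refl) θ₀ θ₁ θ₁' xs ys ys' rewrite dual-exN m (allN n G0) | dual-allN n G0 = go m n
  where
    go : ∀ m n → circ (allN m (exN n (dual G0))) θ₀ θ₁ xs ys ≡ circ (allN m (exN n (dual G0))) θ₀ θ₁' xs ys'
    go (suc m) n = refl
    go zero (suc n) rewrite stripEx-exN n (dual G0) | stripEx-QF (QF-dual q) | qf-QF (QF-dual q) = refl
    go zero zero = go0 q
      where
        go0 : ∀ {H} → QF H → circ (dual H) θ₀ θ₁ xs ys ≡ circ (dual H) θ₀ θ₁' xs ys'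
        go0 posQ = refl
        go0 negQ = refl
        go0 (andQ _ _) = refl
        go0 (orQ _ _) = refl

Σ2-∀-qf : ∀ {F Y} → IsΣ2 F → F ≡ allF Y → qf (stripAll Y) ≡ true
Σ2-∀-qf (zero , suc n , G0 , q , refl) refl rewrite stripAll-allN n G0 | stripAll-QF q = qf-QF q
Σ2-∀-qf (zero , zero , G0 , posQ , refl) ()
Σ2-∀-qf (zero , zero , G0 , negQ , refl) ()
Σ2-∀-qf (zero , zero , G0 , andQ _ _ , refl) ()
Σ2-∀-qf (zero , zero , G0 , orQ _ _ , refl) ()
Σ2-∀-qf (suc m , n , G0 , q , refl) ()

units : ℕ → List Tm
units n = replicate n unit

map-shift-units : ∀ k d n → map (shift k d) (units n) ≡ units n
map-shift-units k d n = map-replicate (shift k d) n unit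

map-shift-units-++ : ∀ k d n m → map (shift k d) (units n ++ units m) ≡ units n ++ units m
map-shift-units-++ k d n m = trans (map-++ (shift k d) (units n) (units m)) (cong₂ _++_ (map-shift-units k d n) (map-shift-units k d m))

circ-dualΣ2-closed : ∀ {F} → IsΣ2 F → ∀ k d θ₀ θ₁ n ys → shift k d (circ (dual F) θ₀ θ₁ (units n) ys) ≡ circ (dual F) θ₀ θ₁ (units n) ys
circ-dualΣ2-closed {F} σ k d θ₀ θ₁ n ys =
  trans (ShiftHom.f-circ d k (dual F) θ₀ θ₁ (units n) ys)
    (trans (cong (λ z → circ (dual F) θ₀ θ₁ z (map (shift k d) ys)) (map-shift-units k d n))
      (circ-dualΣ2-indep σ θ₀ θ₁ θ₁ (units n) (map (shift k d) ys) ys))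

module _ (c : ℕ) where
  ⇛-lamN : ∀ m {a b} → _⇛_ c a b → _⇛_ c (lamN m a) (lamN m b)
  ⇛-lamN zero p = p
  ⇛-lamN (suc m) p = plam (⇛-lamN m p)

  circ-≈ : ∀ X θ₀ θ₀' θ₁ xs xs' ys →
    (∀ Y → X ≡ allF Y → qf (stripAll Y) ≡ false → ∀ k →
        _≈_ c (apps (nt θ₀ 0) (vars k ∷ map (shift 0 k) xs)) (apps (nt θ₀' 0) (vars k ∷ map (shift 0 k) xs'))) →
    (∀ Y → X ≡ exF Y →
        _≈_ c (apps (nt θ₀ 0) (circ (dual X) θ₁ θ₀ ys xs ∷ xs)) (apps (nt θ₀' 0) (circ (dual X) θ₁ θ₀' ys xs' ∷ xs'))) →
    _≈_ c (circ X θ₀ θ₁ xs ys) (circ X θ₀' θ₁ xs' ys)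
  circ-≈ (posF x x₁) θ₀ θ₀' θ₁ xs xs' ys H1 H2 = ε
  circ-≈ (negF x x₁) θ₀ θ₀' θ₁ xs xs' ys H1 H2 = ε
  circ-≈ (andF X X₁) θ₀ θ₀' θ₁ xs xs' ys H1 H2 = ε
  circ-≈ (orF X X₁) θ₀ θ₀' θ₁ xs xs' ys H1 H2 = ε
  circ-≈ (allF Y) θ₀ θ₀' θ₁ xs xs' ys H1 H2 with qf (stripAll Y) in eq
  ... | true = ε
  ... | false = ≈-cong c (lamN (leadAll (allF Y))) (⇛-lamN _) (H1 Y refl eq (leadAll (allF Y)))
  circ-≈ (exF Y) θ₀ θ₀' θ₁ xs xs' ys H1 H2 rewrite circ-ex Y θ₀ θ₁ xs ys | circ-ex Y θ₀' θ₁ xs' ys = H2 Y refl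

  circ-≈ʳ : ∀ X θ₀ θ₁ θ₁' xs ys ys' →
    (∀ k → _≈_ c (apps (nt θ₁ 0) (vars k ∷ map (shift 0 k) ys)) (apps (nt θ₁' 0) (vars k ∷ map (shift 0 k) ys'))) →
    _≈_ c (circ X θ₀ θ₁ xs ys) (circ X θ₀ θ₁' xs ys')
  circ-≈ʳ (posF x x₁) θ₀ θ₁ θ₁' xs ys ys' H = ε
  circ-≈ʳ (negF x x₁) θ₀ θ₁ θ₁' xs ys ys' H = ε
  circ-≈ʳ (andF X X₁) θ₀ θ₁ θ₁' xs ys ys' H = ε
  circ-≈ʳ (orF X X₁) θ₀ θ₁ θ₁' xs ys ys' H = ε
  circ-≈ʳ (allF X) θ₀ θ₁ θ₁' xs ys ys' H = ε
  circ-≈ʳ (exF Y) θ₀ θ₁ θ₁' xs ys ys' H with qf (stripEx Y)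
  ... | true = ε
  ... | false = ≈-arg₁ c θ₀ 0 xs (≈-cong c (lamN (leadEx (exF Y))) (⇛-lamN _) (H (leadEx (exF Y))))

-- Arities and the indices moved by the final block swap

arity-⊢ : ∀ {ρ Γ} → ρ ⊢ Γ → arity ρ ≡ length Γ
arity-⊢ axD = refl
arity-⊢ (orD d) = cong pred (arity-⊢ d)
arity-⊢ (andD d e) = arity-⊢ d
arity-⊢ (allD _ _ d) = arity-⊢ d
arity-⊢ (exD _ d) = arity-⊢ d
arity-⊢ (cutD {Γ = Γ} d e) = trans (cong₂ _+_ (cong pred (arity-⊢ d)) (cong pred (arity-⊢ e))) (sym (length-++ Γ))
arity-⊢ (weakD d) = cong suc (arity-⊢ d)
arity-⊢ (contrD d) = cong pred (arity-⊢ d)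
arity-⊢ (permD {Γ = Γ} d) = trans (arity-⊢ d) (trans (length-++ Γ) (sym (length-++ Γ)))

-- moveLeftIdx k l i is the position in ρ of the i-th formula of the conclusion of
-- moveLeft k l ρ; likewise blockSwapIdx for blockSwap.
moveLeftIdx : ℕ → ℕ → ℕ → ℕ
moveLeftIdx k zero i = i
moveLeftIdx k (suc l) i = moveLeftIdx (suc k) l (swapIdx k i)

blockSwapIdx : ℕ → ℕ → ℕ → ℕ → ℕ
blockSwapIdx g l zero i = i
blockSwapIdx g l (suc d) i = moveLeftIdx g l (blockSwapIdx (suc g) l d i)

arity-moveLeft : ∀ k l ρ → arity (moveLeft k l ρ) ≡ arity ρ
arity-moveLeft k zero ρ = refl
arity-moveLeft k (suc l) ρ = arity-moveLeft (suc k) l ρ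

arity-blockSwap : ∀ g l d ρ → arity (blockSwap g l d ρ) ≡ arity ρ
arity-blockSwap g l zero ρ = refl
arity-blockSwap g l (suc d) ρ = trans (arity-blockSwap (suc g) l d (moveLeft g l ρ)) (arity-moveLeft g l ρ)

swapIdx-< : ∀ {k i} → i < k → swapIdx k i ≡ i
swapIdx-< {k} {i} lt = trans (if-≡ᵇ-else i k (<⇒≢ lt)) (if-≡ᵇ-else i (suc k) (<⇒≢ (m<n⇒m<1+n lt)))

swapIdx-≡ : ∀ k → swapIdx k k ≡ suc k
swapIdx-≡ k = if-≡ᵇ-refl k

swapIdx-suc : ∀ k → swapIdx k (suc k) ≡ k
swapIdx-suc k = trans (if-≡ᵇ-else (suc k) k 1+n≢n) (if-≡ᵇ-refl (suc k))

swapIdx-> : ∀ {k i} → suc k < i → swapIdx k i ≡ i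
swapIdx-> {k} {i} lt = trans (if-≡ᵇ-else i k (λ e → <⇒≢ (<-trans (n<1+n k) lt) (sym e))) (if-≡ᵇ-else i (suc k) (λ e → <⇒≢ lt (sym e)))

swapIdx-bound : ∀ {k i n} → i < n → suc k < n → swapIdx k i < n
swapIdx-bound {k} {i} {n} lt kl with <-cmp i k
... | tri< a _ _ = subst (_< n) (sym (swapIdx-< a)) lt
... | tri≈ _ refl _ = subst (_< n) (sym (swapIdx-≡ k)) kl
... | tri> _ _ c with <-cmp i (suc k)
...   | tri< a _ _ = ⊥-elim (<⇒≱ a c)
...   | tri≈ _ refl _ = subst (_< n) (sym (swapIdx-suc k)) (<-trans (n<1+n k) kl)
...   | tri> _ _ c' = subst (_< n) (sym (swapIdx-> c')) lt

+-suc-< : ∀ a d {n} → a + suc d ≤ n → a < n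
+-suc-< a d {n} le = ≤-trans (s≤s (m≤m+n a d)) (subst (_≤ n) (+-suc a d) le)

moveLeftIdx-bound : ∀ l {k i n} → i < n → k + l < n → moveLeftIdx k l i < n
moveLeftIdx-bound zero lt _ = lt
moveLeftIdx-bound (suc l) {k} {n = n} lt kl = moveLeftIdx-bound l (swapIdx-bound lt (≤-trans (s≤s (s≤s (m≤m+n k l))) kl')) kl'
  where
    kl' : suc k + l < n
    kl' = subst (_< n) (+-suc k l) kl

moveLeftIdx-before : ∀ l {k i} → i < k → moveLeftIdx k l i ≡ i
moveLeftIdx-before zero lt = refl
moveLeftIdx-before (suc l) lt = trans (cong (moveLeftIdx _ l) (swapIdx-< lt)) (moveLeftIdx-before l (m<n⇒m<1+n lt))

moveLeftIdx-start : ∀ l k → moveLeftIdx k l k ≡ k + l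
moveLeftIdx-start zero k = sym (+-identityʳ k)
moveLeftIdx-start (suc l) k = trans (cong (moveLeftIdx (suc k) l) (swapIdx-≡ k)) (trans (moveLeftIdx-start l (suc k)) (sym (+-suc k l)))

moveLeftIdx-block : ∀ l {k i} → k < i → i ≤ k + l → moveLeftIdx k l i ≡ pred i
moveLeftIdx-block zero {k} lt le = ⊥-elim (<⇒≱ lt (subst (_ ≤_) (+-identityʳ k) le))
moveLeftIdx-block (suc l) {k} {i} lt le with <-cmp i (suc k)
... | tri< a _ _ = ⊥-elim (<⇒≱ a lt)
... | tri≈ _ refl _ = trans (cong (moveLeftIdx (suc k) l) (swapIdx-suc k)) (moveLeftIdx-before l (n<1+n k))
... | tri> _ _ c = trans (cong (moveLeftIdx (suc k) l) (swapIdx-> c)) (moveLeftIdx-block l c (subst (i ≤_) (+-suc k l) le))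

moveLeftIdx-after : ∀ l {k i} → k + l < i → moveLeftIdx k l i ≡ i
moveLeftIdx-after zero lt = refl
moveLeftIdx-after (suc l) {k} {i} lt = trans (cong (moveLeftIdx (suc k) l) (swapIdx-> (≤-trans (s≤s (s≤s (m≤m+n k l))) (subst (_< i) (+-suc k l) lt))))
                             (moveLeftIdx-after l (subst (_< i) (+-suc k l) lt))

+-suc-reassoc : ∀ g l d → g + l + suc d ≡ suc g + l + d
+-suc-reassoc = solve-∀

blockSwapIdx-bound : ∀ d {g l i n} → i < n → g + l + d ≤ n → blockSwapIdx g l d i < n
blockSwapIdx-bound zero lt _ = lt
blockSwapIdx-bound (suc d) {g} {l} {i} {n} lt le =
  moveLeftIdx-bound l (blockSwapIdx-bound d lt (subst (_≤ n) (+-suc-reassoc g l d) le)) (+-suc-< (g + l) d le)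

blockSwapIdx-Γ : ∀ d {g l i} → i < g → blockSwapIdx g l d i ≡ i
blockSwapIdx-Γ zero lt = refl
blockSwapIdx-Γ (suc d) {g} {l} lt = trans (cong (moveLeftIdx g l) (blockSwapIdx-Γ d (m<n⇒m<1+n lt))) (moveLeftIdx-before l lt)

blockSwapIdx-Δ : ∀ d {g l j} → j < d → blockSwapIdx g l d (g + j) ≡ g + l + j
blockSwapIdx-Δ (suc d) {g} {l} {zero} lt =
  trans (cong (moveLeftIdx g l) (blockSwapIdx-Γ d {suc g} (s≤s (≤-reflexive (+-identityʳ g)))))
    (trans (cong (moveLeftIdx g l) (+-identityʳ g)) (trans (moveLeftIdx-start l g) (sym (+-identityʳ (g + l)))))
blockSwapIdx-Δ (suc d) {g} {l} {suc j} (s≤s lt) =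
  trans (cong (λ z → moveLeftIdx g l (blockSwapIdx (suc g) l d z)) (+-suc g j))
    (trans (cong (moveLeftIdx g l) (blockSwapIdx-Δ d {suc g} {l} {j} lt))
      (trans (moveLeftIdx-after l (s≤s (≤-trans (m≤m+n (g + l) j) (≤-reflexive refl))))
        (sym (+-suc (g + l) j))))

blockSwapIdx-Λ : ∀ d {g l j} → j < l → blockSwapIdx g l d (g + d + j) ≡ g + j
blockSwapIdx-Λ zero {g} lt = cong (_+ _) (+-identityʳ g)
blockSwapIdx-Λ (suc d) {g} {l} {j} lt =
  trans (cong (λ z → moveLeftIdx g l (blockSwapIdx (suc g) l d z)) (+-suc-shift g d j))
    (trans (cong (moveLeftIdx g l) (blockSwapIdx-Λ d {suc g} {l} {j} lt))
      (moveLeftIdx-block l (s≤s (m≤m+n g j)) (subst (_≤ g + l) (+-suc g j) (+-monoʳ-≤ g lt))))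
  where
    +-suc-shift : ∀ g d j → g + suc d + j ≡ suc g + d + j
    +-suc-shift = solve-∀

<-+-split : ∀ a b i → i < a + b → i < a ⊎ (Σ ℕ λ j → i ≡ a + j × j < b)
<-+-split zero b i lt = inj₂ (i , refl , lt)
<-+-split (suc a) b zero lt = inj₁ (s≤s z≤n)
<-+-split (suc a) b (suc i) (s≤s lt) with <-+-split a b i lt
... | inj₁ x = inj₁ (s≤s x)
... | inj₂ (j , e , y) = inj₂ (j , cong suc e , y)

units-+ : ∀ a b → units (a + b) ≡ units a ++ units b
units-+ zero b = refl
units-+ (suc a) b = cong (unit ∷_) (units-+ a b)

units-split : ∀ k n → suc (suc k) ≤ n → units n ≡ units k ++ unit ∷ unit ∷ units (n ∸ suc (suc k))
units-split zero (suc (suc n)) _ = refl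
units-split zero (suc zero) (s≤s ())
units-split (suc k) (suc n) (s≤s le) = cong (unit ∷_) (units-split k n le)

-- The two cut orders

module Unfold (c : ℕ) where
  open ParCong c using (rapps; pw-refl)

  cutL-unfold : ∀ {A ρ₀ ρ₁ i} xs ys → length xs ≡ pred (arity ρ₀) → length ys ≡ pred (arity ρ₁) → i < length xs →
    _⇛_ c (apps (nt (cut A ρ₀ ρ₁) i) (xs ++ ys)) (apps (nt ρ₀ (suc i)) (circ (dual A) ρ₁ ρ₀ ys xs ∷ xs))
  cutL-unfold {i = i} xs ys lx ly lt =
    pdev dcut (subst (i <_) (cong₂ _+_ lx ly) (≤-trans lt (m≤m+n (length xs) (length ys))))
      (trans (length-++ xs) (cong₂ _+_ lx ly)) (pw-refl (xs ++ ys)) (cutL {xs = xs} {ys = ys} lx lt)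

  cutR-unfold : ∀ {A ρ₀ ρ₁ i} xs ys → length xs ≡ pred (arity ρ₀) → length ys ≡ pred (arity ρ₁) → length xs ≤ i →
    i < length xs + length ys →
    _⇛_ c (apps (nt (cut A ρ₀ ρ₁) i) (xs ++ ys)) (apps (nt ρ₁ (suc (i ∸ length xs))) (circ A ρ₀ ρ₁ xs ys ∷ ys))
  cutR-unfold {i = i} xs ys lx ly le lt =
    pdev dcut (subst (i <_) (cong₂ _+_ lx ly) lt)
      (trans (length-++ xs) (cong₂ _+_ lx ly)) (pw-refl (xs ++ ys)) (cutR {xs = xs} {ys = ys} lx le)

  perm-unfold : ∀ {k ρ i} xs z₀ z₁ ys → length xs ≡ k → i < arity ρ → length (xs ++ z₀ ∷ z₁ ∷ ys) ≡ arity ρ →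
    _⇛_ c (apps (nt (perm k ρ) i) (xs ++ z₀ ∷ z₁ ∷ ys)) (apps (nt ρ (swapIdx k i)) (xs ++ z₁ ∷ z₀ ∷ ys))
  perm-unfold xs z₀ z₁ ys lx lt le = pdev dperm lt le (pw-refl _) (permP {xs = xs} {z₀} {z₁} {ys} lx)

  moveLeft-≈ : ∀ l k ρ i n → arity ρ ≡ n → i < n → k + l < n →
       _≈_ c (apps (nt (moveLeft k l ρ) i) (units n)) (apps (nt ρ (moveLeftIdx k l i)) (units n))
  moveLeft-≈ zero k ρ i n ar lt kl = ε
  moveLeft-≈ (suc l) k ρ i n ar lt kl =
    ⇛⇒≈ c (subst₂ (λ a b → _⇛_ c (apps (nt (perm k ρ') i) a) (apps (nt ρ' (swapIdx k i)) b)) (sym e) (sym e)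
             (perm-unfold (units k) unit unit (units (n ∸ suc (suc k))) (length-replicate k)
               (subst (i <_) (sym ar') lt) (trans (cong length (sym e)) (trans (length-replicate n) (sym ar')))))
    ◅◅ moveLeft-≈ l (suc k) ρ (swapIdx k i) n ar (swapIdx-bound lt k2) (subst (_< n) (+-suc k l) kl)
    where
      ρ' = moveLeft (suc k) l ρ
      ar' : arity ρ' ≡ n
      ar' = trans (arity-moveLeft (suc k) l ρ) ar
      k2 : suc k < n
      k2 = ≤-trans (s≤s (s≤s (m≤m+n k l))) (subst (_< n) (+-suc k l) kl)
      e : units n ≡ units k ++ unit ∷ unit ∷ units (n ∸ suc (suc k))
      e = units-split k n k2

  blockSwap-≈ : ∀ d g l ρ i n → arity ρ ≡ n → i < n → g + l + d ≤ n →
       _≈_ c (apps (nt (blockSwap g l d ρ) i) (units n)) (apps (nt ρ (blockSwapIdx g l d i)) (units n))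
  blockSwap-≈ zero g l ρ i n ar lt le = ε
  blockSwap-≈ (suc d) g l ρ i n ar lt le =
    blockSwap-≈ d (suc g) l (moveLeft g l ρ) i n (trans (arity-moveLeft g l ρ) ar) lt le'
    ◅◅ moveLeft-≈ l g ρ (blockSwapIdx (suc g) l d i) n ar (blockSwapIdx-bound d lt le') (+-suc-< (g + l) d le)
    where
      le' : suc g + l + d ≤ n
      le' = subst (_≤ n) (+-suc-reassoc g l d) le

module CutSwap (c : ℕ) (F G : Formula) (Γ Δ Λ : List Formula) (π₀ π₁ π₂ : Proof)
  (ar₀ : arity π₀ ≡ suc (suc (length Γ))) (ar₁ : arity π₁ ≡ suc (length Δ)) (ar₂ : arity π₂ ≡ suc (length Λ)) where

  open Unfold c

  g dl l : ℕ
  g = length Γ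
  dl = length Δ
  l = length Λ

  Γu Δu Λu : List Tm
  Γu = units g
  Δu = units dl
  Λu = units l

  ρF ρFG ρ₀ˢ ρG ρGF : Proof
  ρF = cut F π₀ π₁
  ρFG = cut G ρF π₂
  ρ₀ˢ = perm 0 π₀
  ρG = cut G ρ₀ˢ π₂
  ρGF = cut F ρG π₁

  -- π₀F x and π₀G are what σ_π₀ receives at F and G inside π (x being its G-argument), π₁F and
  -- π₂G what σ_π₁ and σ_π₂ receive; primed: the same inside π' (w being π₀'s F-argument).
  π₀F' π₀G π₁F' π₂G : Tm
  π₀F' = circ (dual F) π₁ ρG Δu (Γu ++ Λu)
  π₀G = circ (dual G) π₂ ρF Λu (Γu ++ Δu)
  π₁F' = circ F ρG π₁ (Γu ++ Λu) Δu
  π₂G = circ G ρF π₂ (Γu ++ Δu) Λu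

  π₀F π₀G' π₁F π₂G' : Tm → Tm
  π₀F x = circ (dual F) π₁ π₀ Δu (x ∷ Γu)
  π₀G' w = circ (dual G) π₂ ρ₀ˢ Λu (w ∷ Γu)
  π₁F x = circ F π₀ π₁ (x ∷ Γu) Δu
  π₂G' w = circ G ρ₀ˢ π₂ (w ∷ Γu) Λu

  length-π₀ : ∀ x → length (x ∷ Γu) ≡ pred (arity π₀)
  length-π₀ _ = trans (cong suc (length-replicate g)) (sym (cong pred ar₀))

  length-π₁ : length Δu ≡ pred (arity π₁)
  length-π₁ = trans (length-replicate dl) (sym (cong pred ar₁))

  length-π₂ : length Λu ≡ pred (arity π₂)
  length-π₂ = trans (length-replicate l) (sym (cong pred ar₂))

  arity-π₀ : ∀ a w → length (a ∷ w ∷ Γu) ≡ arity π₀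
  arity-π₀ _ _ = trans (cong (λ z → suc (suc z)) (length-replicate g)) (sym ar₀)

  ρF-unfold : ∀ a → _⇛_ c (apps (nt ρF 0) (a ∷ Γu ++ Δu)) (apps (nt π₀ 1) (π₀F a ∷ a ∷ Γu))
  ρF-unfold a = cutL-unfold (a ∷ Γu) Δu (length-π₀ a) length-π₁ (s≤s z≤n)

  ρ₀ˢ-unfold : ∀ a w → _⇛_ c (apps (nt ρ₀ˢ 0) (a ∷ w ∷ Γu)) (apps (nt π₀ 1) (w ∷ a ∷ Γu))
  ρ₀ˢ-unfold a w = perm-unfold [] a w Γu refl (subst (0 <_) (sym ar₀) (s≤s z≤n)) (arity-π₀ a w)

  ρG-unfold : ∀ a → _⇛_ c (apps (nt ρG 0) (a ∷ Γu ++ Λu)) (apps (nt ρ₀ˢ 1) (π₀G' a ∷ a ∷ Γu))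
  ρG-unfold a = cutL-unfold (a ∷ Γu) Λu (length-π₀ a) length-π₂ (s≤s z≤n)

  ρ₀ˢ-unfold₁ : ∀ a → _⇛_ c (apps (nt ρ₀ˢ 1) (π₀G' a ∷ a ∷ Γu)) (apps (nt π₀ 0) (a ∷ π₀G' a ∷ Γu))
  ρ₀ˢ-unfold₁ a = perm-unfold [] (π₀G' a) a Γu refl (subst (1 <_) (sym ar₀) (s≤s (s≤s z≤n))) (arity-π₀ (π₀G' a) a)

  module FΣ (σF : IsΣ2 F) where
    π₀F-const : ∀ x → π₀F x ≡ π₀F'
    π₀F-const x = circ-dualΣ2-indep σF π₁ π₀ ρG Δu (x ∷ Γu) (Γu ++ Λu)

    ρF≈ρ₀ˢ : ∀ a → _≈_ c (apps (nt ρF 0) (a ∷ Γu ++ Δu)) (apps (nt ρ₀ˢ 0) (a ∷ π₀F' ∷ Γu))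
    ρF≈ρ₀ˢ a = ⇛⇒≈ c (subst (λ z → _⇛_ c (apps (nt ρF 0) (a ∷ Γu ++ Δu)) (apps (nt π₀ 1) (z ∷ a ∷ Γu))) (π₀F-const a) (ρF-unfold a))
               ◅◅ ⇚⇒≈ c (ρ₀ˢ-unfold a π₀F')

    ρF≈ρ₀ˢ-vars : ∀ k → _≈_ c (apps (nt ρF 0) (vars k ∷ map (shift 0 k) (Γu ++ Δu)))
                              (apps (nt ρ₀ˢ 0) (vars k ∷ map (shift 0 k) (π₀F' ∷ Γu)))
    ρF≈ρ₀ˢ-vars k rewrite map-shift-units-++ 0 k g dl | map-shift-units 0 k g
                        | circ-dualΣ2-closed σF 0 k π₁ ρG dl (Γu ++ Λu) = ρF≈ρ₀ˢ (vars k)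

    π₀G≈ : _≈_ c π₀G (π₀G' π₀F')
    π₀G≈ = circ-≈ʳ c (dual G) π₂ ρF ρ₀ˢ Λu (Γu ++ Δu) (π₀F' ∷ Γu) ρF≈ρ₀ˢ-vars

    π₂G≈ : _≈_ c π₂G (π₂G' π₀F')
    π₂G≈ = circ-≈ c G ρF ρ₀ˢ π₂ (Γu ++ Δu) (π₀F' ∷ Γu) Λu (λ _ _ _ → ρF≈ρ₀ˢ-vars)
      (λ _ e → subst (λ z → _≈_ c (apps (nt ρF 0) (π₀G ∷ Γu ++ Δu)) (apps (nt ρ₀ˢ 0) (z ∷ π₀F' ∷ Γu)))
                     (circ-dual∃-indep e π₂ ρF ρ₀ˢ Λu (Γu ++ Δu) (π₀F' ∷ Γu)) (ρF≈ρ₀ˢ _))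

  module GΣ (σG : IsΣ2 G) where
    π₀G'-const : ∀ w → π₀G' w ≡ π₀G
    π₀G'-const w = circ-dualΣ2-indep σG π₂ ρ₀ˢ ρF Λu (w ∷ Γu) (Γu ++ Δu)

    π₀≈ρG : ∀ a → _≈_ c (apps (nt π₀ 0) (a ∷ π₀G ∷ Γu)) (apps (nt ρG 0) (a ∷ Γu ++ Λu))
    π₀≈ρG a = ⇚⇒≈ c (subst (λ z → _⇛_ c (apps (nt ρ₀ˢ 1) (z ∷ a ∷ Γu)) (apps (nt π₀ 0) (a ∷ z ∷ Γu))) (π₀G'-const a) (ρ₀ˢ-unfold₁ a))
              ◅◅ ⇚⇒≈ c (subst (λ z → _⇛_ c (apps (nt ρG 0) (a ∷ Γu ++ Λu)) (apps (nt ρ₀ˢ 1) (z ∷ a ∷ Γu))) (π₀G'-const a) (ρG-unfold a))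

    π₀≈ρG-vars : ∀ k → _≈_ c (apps (nt π₀ 0) (vars k ∷ map (shift 0 k) (π₀G ∷ Γu)))
                             (apps (nt ρG 0) (vars k ∷ map (shift 0 k) (Γu ++ Λu)))
    π₀≈ρG-vars k rewrite map-shift-units-++ 0 k g l | map-shift-units 0 k g
                       | circ-dualΣ2-closed σG 0 k π₂ ρF l (Γu ++ Δu) = π₀≈ρG (vars k)

    π₀F≈ : _≈_ c (π₀F π₀G) π₀F'
    π₀F≈ = circ-≈ʳ c (dual F) π₁ π₀ ρG Δu (π₀G ∷ Γu) (Γu ++ Λu) π₀≈ρG-vars

    π₁F≈ : _≈_ c (π₁F π₀G) π₁F'
    π₁F≈ = circ-≈ c F π₀ ρG π₁ (π₀G ∷ Γu) (Γu ++ Λu) Δu (λ _ _ _ → π₀≈ρG-vars)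
      (λ _ e → subst (λ z → _≈_ c (apps (nt π₀ 0) (π₀F π₀G ∷ π₀G ∷ Γu)) (apps (nt ρG 0) (z ∷ Γu ++ Λu)))
                     (circ-dual∃-indep e π₁ π₀ ρG Δu (π₀G ∷ Γu) (Γu ++ Λu)) (π₀≈ρG _))

  π₀-args-≈ : IsΣ2 F ⊎ IsΣ2 G → ∀ j → _≈_ c (apps (nt π₀ j) (π₀F π₀G ∷ π₀G ∷ Γu)) (apps (nt π₀ j) (π₀F' ∷ π₀G' π₀F' ∷ Γu))
  π₀-args-≈ (inj₁ σF) j rewrite FΣ.π₀F-const σF π₀G = ≈-arg₂ c π₀ j π₀F' Γu (FΣ.π₀G≈ σF)
  π₀-args-≈ (inj₂ σG) j rewrite GΣ.π₀G'-const σG π₀F' = ≈-arg₁ c π₀ j (π₀G ∷ Γu) (GΣ.π₀F≈ σG)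

  π₁F-≈ : IsΣ2 F ⊎ IsΣ2 G → _≈_ c (π₁F π₀G) π₁F'
  π₁F-≈ (inj₂ σG) = GΣ.π₁F≈ σG
  π₁F-≈ (inj₁ σF) = circ-≈ c F π₀ ρG π₁ (π₀G ∷ Γu) (Γu ++ Λu) Δu
      (λ _ e nq _ → contradiction (trans (sym (Σ2-∀-qf σF e)) nq) λ ())
      (λ _ _ → subst (λ z → _≈_ c (apps (nt π₀ 0) (z ∷ π₀G ∷ Γu)) (apps (nt ρG 0) (π₀F' ∷ Γu ++ Λu))) (sym (FΣ.π₀F-const σF π₀G))
                 (≈-arg₂ c π₀ 0 π₀F' Γu (FΣ.π₀G≈ σF) ◅◅ ⇚⇒≈ c (ρ₀ˢ-unfold₁ π₀F') ◅◅ ⇚⇒≈ c (ρG-unfold π₀F')))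

  π₂G-≈ : IsΣ2 F ⊎ IsΣ2 G → _≈_ c π₂G (π₂G' π₀F')
  π₂G-≈ (inj₁ σF) = FΣ.π₂G≈ σF
  π₂G-≈ (inj₂ σG) = circ-≈ c G ρF ρ₀ˢ π₂ (Γu ++ Δu) (π₀F' ∷ Γu) Λu
      (λ _ e nq _ → contradiction (trans (sym (Σ2-∀-qf σG e)) nq) λ ())
      (λ _ _ → subst (λ z → _≈_ c (apps (nt ρF 0) (π₀G ∷ Γu ++ Δu)) (apps (nt ρ₀ˢ 0) (z ∷ π₀F' ∷ Γu))) (sym (GΣ.π₀G'-const σG π₀F'))
                 (⇛⇒≈ c (ρF-unfold π₀G) ◅◅ ≈-arg₁ c π₀ 1 (π₀G ∷ Γu) (GΣ.π₀F≈ σG) ◅◅ ⇚⇒≈ c (ρ₀ˢ-unfold π₀G π₀F')))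

  n : ℕ
  n = length (Γ ++ Δ ++ Λ)

  n≡ΓΔΛ : n ≡ g + (dl + l)
  n≡ΓΔΛ = trans (length-++ Γ) (cong (g +_) (length-++ Δ))

  n≡ΓΛΔ : n ≡ g + l + dl
  n≡ΓΛΔ = trans n≡ΓΔΛ (+-reorder g dl l)
    where
      +-reorder : ∀ g dl l → g + (dl + l) ≡ g + l + dl
      +-reorder = solve-∀

  units-ΓΔΛ : units n ≡ (Γu ++ Δu) ++ Λu
  units-ΓΔΛ = trans (cong units n≡ΓΔΛ) (trans (units-+ g (dl + l)) (trans (cong (Γu ++_) (units-+ dl l)) (sym (++-assoc Γu Δu Λu))))

  units-ΓΛΔ : units n ≡ (Γu ++ Λu) ++ Δu
  units-ΓΛΔ = trans (cong units n≡ΓΛΔ) (trans (units-+ (g + l) dl) (cong (_++ Δu) (units-+ g l)))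

  length-ΓΔ : length (Γu ++ Δu) ≡ g + dl
  length-ΓΔ = trans (length-++ Γu) (cong₂ _+_ (length-replicate g) (length-replicate dl))

  length-ΓΛ : length (Γu ++ Λu) ≡ g + l
  length-ΓΛ = trans (length-++ Γu) (cong₂ _+_ (length-replicate g) (length-replicate l))

  length-ρF : length (Γu ++ Δu) ≡ pred (arity ρF)
  length-ρF = trans length-ΓΔ (sym (cong₂ (λ a b → pred (pred a + pred b)) ar₀ ar₁))

  length-ρG : length (Γu ++ Λu) ≡ pred (arity ρG)
  length-ρG = trans length-ΓΛ (sym (cong₂ (λ a b → pred (pred a + pred b)) ar₀ ar₂))

  arity-ρGF : arity ρGF ≡ n
  arity-ρGF = trans (cong₂ _+_ (cong₂ (λ a b → pred (pred a + pred b)) ar₀ ar₂) (cong pred ar₁)) (sym n≡ΓΛΔ)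

  σπ σπ' : ℕ → Tm
  σπ i = apps (nt ρFG i) (units n)
  σπ' i = apps (nt (blockSwap g l dl ρGF) i) (units n)

  σπ'-unswap : ∀ i → i < n → _≈_ c (σπ' i) (apps (nt ρGF (blockSwapIdx g l dl i)) (units n))
  σπ'-unswap i lt = blockSwap-≈ dl g l ρGF i n arity-ρGF lt (≤-reflexive (sym n≡ΓΛΔ))

  module _ (hyp : IsΣ2 F ⊎ IsΣ2 G) where

    Γ-root-≈ : ∀ i → i < g → _≈_ c (σπ i) (σπ' i)
    Γ-root-≈ i lt = left ◅◅ π₀-args-≈ hyp (suc (suc i)) ◅◅ ≈-sym c right
      where
        ltn : i < n
        ltn = subst (i <_) (sym n≡ΓΔΛ) (≤-trans lt (m≤m+n g (dl + l)))
        left : _≈_ c (σπ i) (apps (nt π₀ (suc (suc i))) (π₀F π₀G ∷ π₀G ∷ Γu))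
        left = ≡⇒≈ c (cong (apps (nt ρFG i)) units-ΓΔΛ)
               ◅◅ ⇛⇒≈ c (cutL-unfold (Γu ++ Δu) Λu length-ρF length-π₂ (subst (i <_) (sym length-ΓΔ) (≤-trans lt (m≤m+n g dl))))
               ◅◅ ⇛⇒≈ c (cutL-unfold (π₀G ∷ Γu) Δu (length-π₀ π₀G) length-π₁ (s≤s (subst (i <_) (sym (length-replicate g)) lt)))
        right : _≈_ c (σπ' i) (apps (nt π₀ (suc (suc i))) (π₀F' ∷ π₀G' π₀F' ∷ Γu))
        right = σπ'-unswap i ltn ◅◅ ≡⇒≈ c (cong₂ (λ j z → apps (nt ρGF j) z) (blockSwapIdx-Γ dl lt) units-ΓΛΔ)
               ◅◅ ⇛⇒≈ c (cutL-unfold (Γu ++ Λu) Δu length-ρG length-π₁ (subst (i <_) (sym length-ΓΛ) (≤-trans lt (m≤m+n g l))))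
               ◅◅ ⇛⇒≈ c (cutL-unfold (π₀F' ∷ Γu) Λu (length-π₀ π₀F') length-π₂ (s≤s (subst (i <_) (sym (length-replicate g)) lt)))
               ◅◅ ⇛⇒≈ c (perm-unfold [] (π₀G' π₀F') π₀F' Γu refl (subst (suc (suc i) <_) (sym ar₀) (s≤s (s≤s lt))) (arity-π₀ (π₀G' π₀F') π₀F'))

    Δ-root-≈ : ∀ j → j < dl → _≈_ c (σπ (g + j)) (σπ' (g + j))
    Δ-root-≈ j lt = left ◅◅ ≈-arg₁ c π₁ (suc j) Δu (π₁F-≈ hyp) ◅◅ ≈-sym c right
      where
        i = g + j
        ltn : i < n
        ltn = subst (i <_) (sym n≡ΓΔΛ) (+-monoʳ-< g (≤-trans lt (m≤m+n dl l)))
        idx1 : suc i ∸ length (π₀G ∷ Γu) ≡ j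
        idx1 = trans (cong (i ∸_) (length-replicate g)) (m+n∸m≡n g j)
        idx2 : g + l + j ∸ length (Γu ++ Λu) ≡ j
        idx2 = trans (cong (g + l + j ∸_) length-ΓΛ) (m+n∸m≡n (g + l) j)
        left : _≈_ c (σπ i) (apps (nt π₁ (suc j)) (π₁F π₀G ∷ Δu))
        left = ≡⇒≈ c (cong (apps (nt ρFG i)) units-ΓΔΛ)
               ◅◅ ⇛⇒≈ c (cutL-unfold (Γu ++ Δu) Λu length-ρF length-π₂ (subst (i <_) (sym length-ΓΔ) (+-monoʳ-< g lt)))
               ◅◅ ⇛⇒≈ c (cutR-unfold (π₀G ∷ Γu) Δu (length-π₀ π₀G) length-π₁ (s≤s (subst (_≤ i) (sym (length-replicate g)) (m≤m+n g j)))
                          (subst (suc i <_) (sym (cong₂ (λ a b → suc a + b) (length-replicate g) (length-replicate dl))) (s≤s (+-monoʳ-< g lt))))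
               ◅◅ ≡⇒≈ c (cong (λ z → apps (nt π₁ (suc z)) (π₁F π₀G ∷ Δu)) idx1)
        right : _≈_ c (σπ' i) (apps (nt π₁ (suc j)) (π₁F' ∷ Δu))
        right = σπ'-unswap i ltn ◅◅ ≡⇒≈ c (cong₂ (λ j z → apps (nt ρGF j) z) (blockSwapIdx-Δ dl lt) units-ΓΛΔ)
               ◅◅ ⇛⇒≈ c (cutR-unfold (Γu ++ Λu) Δu length-ρG length-π₁ (subst (_≤ g + l + j) (sym length-ΓΛ) (m≤m+n (g + l) j))
                          (subst (g + l + j <_) (sym (cong₂ _+_ length-ΓΛ (length-replicate dl))) (+-monoʳ-< (g + l) lt)))
               ◅◅ ≡⇒≈ c (cong (λ z → apps (nt π₁ (suc z)) (π₁F' ∷ Δu)) idx2)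

    Λ-root-≈ : ∀ j → j < l → _≈_ c (σπ (g + dl + j)) (σπ' (g + dl + j))
    Λ-root-≈ j lt = left ◅◅ ≈-arg₁ c π₂ (suc j) Λu (π₂G-≈ hyp) ◅◅ ≈-sym c right
      where
        i = g + dl + j
        ltn : i < n
        ltn = subst (_< n) (sym (+-assoc g dl j)) (subst ((g + (dl + j)) <_) (sym n≡ΓΔΛ) (+-monoʳ-< g (+-monoʳ-< dl lt)))
        idx1 : i ∸ length (Γu ++ Δu) ≡ j
        idx1 = trans (cong (i ∸_) length-ΓΔ) (m+n∸m≡n (g + dl) j)
        idx2 : suc (g + j) ∸ length (π₀F' ∷ Γu) ≡ j
        idx2 = trans (cong (g + j ∸_) (length-replicate g)) (m+n∸m≡n g j)
        left : _≈_ c (σπ i) (apps (nt π₂ (suc j)) (π₂G ∷ Λu))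
        left = ≡⇒≈ c (cong (apps (nt ρFG i)) units-ΓΔΛ)
               ◅◅ ⇛⇒≈ c (cutR-unfold (Γu ++ Δu) Λu length-ρF length-π₂ (subst (_≤ i) (sym length-ΓΔ) (m≤m+n (g + dl) j))
                          (subst (i <_) (sym (cong₂ _+_ length-ΓΔ (length-replicate l))) (+-monoʳ-< (g + dl) lt)))
               ◅◅ ≡⇒≈ c (cong (λ z → apps (nt π₂ (suc z)) (π₂G ∷ Λu)) idx1)
        right : _≈_ c (σπ' i) (apps (nt π₂ (suc j)) (π₂G' π₀F' ∷ Λu))
        right = σπ'-unswap i ltn ◅◅ ≡⇒≈ c (cong₂ (λ j z → apps (nt ρGF j) z) (blockSwapIdx-Λ dl lt) units-ΓΛΔ)
               ◅◅ ⇛⇒≈ c (cutL-unfold (Γu ++ Λu) Δu length-ρG length-π₁ (subst (g + j <_) (sym length-ΓΛ) (+-monoʳ-< g lt)))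
               ◅◅ ⇛⇒≈ c (cutR-unfold (π₀F' ∷ Γu) Λu (length-π₀ π₀F') length-π₂ (s≤s (subst (_≤ g + j) (sym (length-replicate g)) (m≤m+n g j)))
                          (subst (suc (g + j) <_) (sym (cong₂ (λ a b → suc a + b) (length-replicate g) (length-replicate l))) (s≤s (+-monoʳ-< g lt))))
               ◅◅ ≡⇒≈ c (cong (λ z → apps (nt π₂ (suc z)) (π₂G' π₀F' ∷ Λu)) idx2)

    root-≈ : ∀ i → i < n → _≈_ c (σπ i) (σπ' i)
    root-≈ i lt with <-+-split g (dl + l) i (subst (i <_) n≡ΓΔΛ lt)
    ... | inj₁ x = Γ-root-≈ i x
    ... | inj₂ (j , refl , y) with <-+-split dl l j y
    ...   | inj₁ x = Δ-root-≈ j x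
    ...   | inj₂ (k , refl , z) = subst (λ w → _≈_ c (σπ w) (σπ' w)) (+-assoc g dl k) (Λ-root-≈ k z)

lemma3 : (c : ℕ) (F G : Formula) (Γ Δ Λ : List Formula) (π₀ π₁ π₂ : Proof)
    (d₀ : π₀ ⊢ F ∷ G ∷ Γ) (d₁ : π₁ ⊢ dual F ∷ Δ) (d₂ : π₂ ⊢ dual G ∷ Λ) →
    AllPrenex d₀ → AllPrenex d₁ → AllPrenex d₂ →
    Regular (piFG F G π₀ π₁ π₂) → Regular (piGF Γ Δ Λ F G π₀ π₁ π₂) →
    All IsΣ1 (Γ ++ Δ ++ Λ) →
    IsΣ2 F ⊎ IsΣ2 G →
    ∀ p → L c (piFG F G π₀ π₁ π₂) (Γ ++ Δ ++ Λ) p ⇔ L c (piGF Γ Δ Λ F G π₀ π₁ π₂) (Γ ++ Δ ++ Λ) p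
lemma3 c F G Γ Δ Λ π₀ π₁ π₂ d₀ d₁ d₂ _ _ _ _ _ _ hyp = L-≈ c (Γ ++ Δ ++ Λ) (root-≈ hyp)
  where open CutSwap c F G Γ Δ Λ π₀ π₁ π₂ (arity-⊢ d₀) (arity-⊢ d₁) (arity-⊢ d₂)
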